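{- The $\mathbf{Gr}(\mathbf{K}_{\mathcal{R}^{ -1}_\cap})$-algorithm is a non-deterministic decision procedure for satisfiability of $\mathbf{Gr}(\mathbf{K}_{\mathcal{R}^{ -1}_\cap})$-formulae in negation normal form: for every such formula $\phi$, every sequence of rule applications starting from $\{x_0\models\phi\}$ is finite, and $\phi$ is satisfiable iff some such sequence results in a complete and clash-free constraint system.
   Context: Let $\overline{\mathcal{R}}=\mathcal{R}\cup\{R^{ -1}:R\in\mathcal{R}\}$ with $(R^{ -1})^{ -1}=R$. Formulae in NNF: $p$, $\neg p$, $\psi_1\wedge\psi_2$, $\psi_1\vee\psi_2$, $\langle\omega\rangle_{\ge n}\psi$, $\langle\omega\rangle_{\le n}\psi$, where $\omega=R_1\cap\dots\cap R_k$ with $R_i\in\overline{\mathcal{R}}$ (identified with the set $\{R_1,\dots,R_k\}$); semantically these say at least / at most $n$ worlds $y$ with $(x,y)\in R_i^\mathfrak{M}$ for all $i$ satisfy $\psi$, where $(R^{ -1})^\mathfrak{M}$ is the converse of $R^\mathfrak{M}$. $\sim\psi$ is the NNF of $\neg\psi$ (De Morgan, $\neg\langle\omega\rangle_{\ge 0}\psi\equiv p\wedge\neg p$, $\neg\langle\omega\rangle_{\ge n}\psi\equiv\langle\omega\rangle_{\le n-1}\psi$ for $n\ge1$, $\neg\langle\omega\rangle_{\le n}\psi\equiv\langle\omega\rangle_{\ge n+1}\psi$). A constraint system (c.s.) $S$ is a finite set of expressions $x\models\psi$ and $Rxy$ ($R\in\overline{\mathcal{R}}$) such that $Rxy\in S$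 iff $R^{ -1}yx\in S$; $\sharp\omega^S(x,\psi)$ is the number of $y$ with $\{R_1xy,\dots,R_kxy,y\models\psi\}\subseteq S$. The algorithm maintains a relation $\prec_S$ on variables ($x\prec_S y$ iff $y$ was created by the $\ge$-rule for $x$), $\prec_S^+$ its transitive closure. Rules: ($\wedge$) if $x\models\psi_1\wedge\psi_2\in S$ and not both conjunct constraints in $S$, add both; ($\vee$) if $x\models\psi_1\vee\psi_2\in S$ and neither disjunct constraint in $S$, add $x\models\chi$ for a chosen $\chi\in\{\psi_1,\psi_2\}$; (choose) if $x\models\langle\omega\rangle_{\bowtie n}\psi\in S$ ($\bowtie\in\{\le,\ge\}$), and for some $R\in\omega$ there is $y$ with $Rxy\in S$ and $\{y\models\psi,y\models\sim\psi\}\cap S=\emptyset$, then replace $S$ by $S'\cup\{y\models\chi\}$ with $\chi\in\{\psi,\sim\psi\}$ chosen nondeterministically, where $S'$ is $S$ with all constraints mentioning some variable $z$ with $y\prec_S^+z$ removed; ($\ge$) if $x\models\langle\omega\rangle_{\ge n}\psi\in S$, $\sharp\omega^S(x,\psi)<n$, and none of the $\wedge$-, $\vee$-, choose-rules can be applied to a constraint for $x$, then for a fresh $y$ add $y\models\psi$, $y\models\chi_1,\dots,y\models\chi_k$ where $\{\psi_1,\dots,\psi_k\}=\{\psi':x\models\langle\sigma\rangle_{\bowtie m}\psi'\in S$ for some $\sigma,m,\bowtie\}$ and $\chi_i\in\{\psi_i,\sim\psi_i\}$ chosen nondeterministically, and add $R_jxy,R_j^{ -1}yx$ for $j=1,\dots,m$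 for a nondeterministically chosen set with $\omega\subseteq\{R_1,\dots,R_m\}\subseteq\overline{\mathcal{R}}$, and set $x\prec_S y$. A c.s. is complete if no rule applies; it contains a clash if $\{x\models p,x\models\neg p\}\subseteq S$ for some $x$ and atom $p$, or $x\models\langle\omega\rangle_{\le n}\psi\in S$ and $\sharp\omega^S(x,\psi)>n$; otherwise it is clash-free. -}

module Defs where

open import Level using (0ℓ)
open import Data.Nat using (ℕ; zero; suc)
open import Data.Fin using (Fin)
open import Data.Bool using (Bool; true; false; if_then_else_)
open import Data.List using (List)
open import Data.List.NonEmpty using (List⁺; toList)
open import Data.List.Membership.Propositional using (_∈_)
open import Data.List.Relation.Unary.All using (All)
open import Data.Product using (Σ; _×_; _,_; ∃; ∃-syntax)
open import Data.Sum using (_⊎_)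
open import Data.Empty using (⊥)
open import Relation.Nullary using (¬_)
open import Relation.Binary.PropositionalEquality using (_≡_)
open import Relation.Binary.Construct.Closure.Transitive using (TransClosure)
open import Relation.Binary.Construct.Closure.ReflexiveTransitive using (Star)
open import Function.Definitions using (Injective)

AtLeast : ∀ {A : Set} → ℕ → (A → Set) → Set
AtLeast {A} n P = Σ (Fin n → A) λ f → Injective _≡_ _≡_ f × (∀ i → P (f i))

-- Parameters: atoms, relation names, and a fixed atom p₀ used for p₀ ∧ ¬p₀.
module Gr (Atom RName : Set) (p₀ : Atom) where

  data RelLit : Set where
    pos : RName → RelLit
    inv : RName → RelLit

  _⁻¹ : RelLit → RelLit
  pos r ⁻¹ = inv r
  inv r ⁻¹ = pos r

  Inter : Set
  Inter = List⁺ RelLit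

  data Fm : Set where
    var  : Atom → Fm
    nvar : Atom → Fm
    _∧′_ : Fm → Fm → Fm
    _∨′_ : Fm → Fm → Fm
    dia≥ : Inter → ℕ → Fm → Fm
    dia≤ : Inter → ℕ → Fm → Fm

  ∼_ : Fm → Fm
  ∼ var p = nvar p
  ∼ nvar p = var p
  ∼ (a ∧′ b) = (∼ a) ∨′ (∼ b)
  ∼ (a ∨′ b) = (∼ a) ∧′ (∼ b)
  ∼ dia≥ ω zero ψ = var p₀ ∧′ nvar p₀
  ∼ dia≥ ω (suc n) ψ = dia≤ ω n ψ
  ∼ dia≤ ω n ψ = dia≥ ω (suc n) ψ

  record Model : Set₁ where
    field
      W   : Set
      rel : RName → W → W → Set
      val : Atom → W → Set

  module _ (M : Model) where
    open Model M

    relSem : RelLit → W → W → Set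
    relSem (pos r) x y = rel r x y
    relSem (inv r) x y = rel r y x

    Succ : Inter → W → W → Set
    Succ ω x y = All (λ R → relSem R x y) (toList ω)

    _⊨_ : W → Fm → Set
    x ⊨ var p = val p x
    x ⊨ nvar p = ¬ val p x
    x ⊨ (a ∧′ b) = (x ⊨ a) × (x ⊨ b)
    x ⊨ (a ∨′ b) = (x ⊨ a) ⊎ (x ⊨ b)
    x ⊨ dia≥ ω n ψ = AtLeast n (λ y → Succ ω x y × (y ⊨ ψ))
    x ⊨ dia≤ ω n ψ = ¬ AtLeast (suc n) (λ y → Succ ω x y × (y ⊨ ψ))

  Satisfiable : Fm → Set₁
  Satisfiable φ = Σ Model λ M → Σ (Model.W M) λ w → _⊨_ M w φ

  data Con : Set where
    _⊨c_ : ℕ → Fm → Con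
    edge : RelLit → ℕ → ℕ → Con

  Mentions : Con → ℕ → Set
  Mentions (u ⊨c ψ) z = u ≡ z
  Mentions (edge R u v) z = (u ≡ z) ⊎ (v ≡ z)

  -- a state: the c.s. S (as a set of constraints) together with ≺_S
  record State : Set₁ where
    constructor ⟨_,_⟩
    field
      cs   : Con → Set
      prec : ℕ → ℕ → Set
  open State public

  Counted : State → ℕ → Inter → Fm → ℕ → Set
  Counted S x ω ψ y = All (λ R → cs S (edge R x y)) (toList ω) × cs S (y ⊨c ψ)

  ModalAt : State → ℕ → Inter → Fm → Set
  ModalAt S x σ ψ = ∃[ m ] (cs S (x ⊨c dia≥ σ m ψ) ⊎ cs S (x ⊨c dia≤ σ m ψ))

  Fresh : State → ℕ → Set
  Fresh S y = (∀ c → cs S c → ¬ Mentions c y) × (∀ u → ¬ prec S u y) × (∀ u → ¬ prec S y u)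

  ∧Applicable : State → ℕ → Set
  ∧Applicable S x = ∃[ a ] ∃[ b ] (cs S (x ⊨c (a ∧′ b)) × ¬ (cs S (x ⊨c a) × cs S (x ⊨c b)))

  ∨Applicable : State → ℕ → Set
  ∨Applicable S x = ∃[ a ] ∃[ b ] (cs S (x ⊨c (a ∨′ b)) × ¬ cs S (x ⊨c a) × ¬ cs S (x ⊨c b))

  ChooseApplicable : State → ℕ → Inter → Fm → ℕ → Set
  ChooseApplicable S x ω ψ y =
    ModalAt S x ω ψ × (∃[ R ] (R ∈ toList ω × cs S (edge R x y)))
    × ¬ cs S (y ⊨c ψ) × ¬ cs S (y ⊨c (∼ ψ))

  NoLocalRule : State → ℕ → Set
  NoLocalRule S x = ¬ ∧Applicable S x × ¬ ∨Applicable S x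
                    × (∀ ω ψ y → ¬ ChooseApplicable S x ω ψ y)

  pick : Bool → Fm → Fm
  pick b ψ = if b then ψ else ∼ ψ

  data Step : State → State → Set₁ where
    ∧-rule : ∀ S x a b →
      cs S (x ⊨c (a ∧′ b)) → ¬ (cs S (x ⊨c a) × cs S (x ⊨c b)) →
      Step S ⟨ (λ c → cs S c ⊎ c ≡ (x ⊨c a) ⊎ c ≡ (x ⊨c b)) , prec S ⟩
    ∨-rule : ∀ S x a b χ →
      cs S (x ⊨c (a ∨′ b)) → ¬ cs S (x ⊨c a) → ¬ cs S (x ⊨c b) →
      (χ ≡ a ⊎ χ ≡ b) →
      Step S ⟨ (λ c → cs S c ⊎ c ≡ (x ⊨c χ)) , prec S ⟩
    choose-rule : ∀ S x ω ψ y (b : Bool) →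
      ChooseApplicable S x ω ψ y →
      Step S ⟨ (λ c → (cs S c × ¬ (∃[ z ] (TransClosure (prec S) y z × Mentions c z)))
                      ⊎ c ≡ (y ⊨c pick b ψ)) , prec S ⟩
    ≥-rule : ∀ S x ω n ψ y (choice : Fm → Bool) (Rs : List RelLit) →
      cs S (x ⊨c dia≥ ω n ψ) →
      ¬ AtLeast n (Counted S x ω ψ) →
      NoLocalRule S x →
      Fresh S y →
      All (_∈ Rs) (toList ω) →
      Step S ⟨ (λ c → cs S c
                      ⊎ c ≡ (y ⊨c ψ)
                      ⊎ (∃[ ψ′ ] ((∃[ σ ] ModalAt S x σ ψ′) × c ≡ (y ⊨c pick (choice ψ′) ψ′)))
                      ⊎ (∃[ R ] (R ∈ Rs × (c ≡ edge R x y ⊎ c ≡ edge (R ⁻¹) y x))))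
             , (λ u v → prec S u v ⊎ (u ≡ x × v ≡ y)) ⟩

  initial : Fm → State
  initial φ = ⟨ (λ c → c ≡ (0 ⊨c φ)) , (λ _ _ → ⊥) ⟩

  Complete : State → Set₁
  Complete S = ∀ S′ → ¬ Step S S′

  Clash : State → Set
  Clash S = (∃[ x ] ∃[ p ] (cs S (x ⊨c var p) × cs S (x ⊨c nvar p)))
          ⊎ (∃[ x ] ∃[ ω ] ∃[ n ] ∃[ ψ ] (cs S (x ⊨c dia≤ ω n ψ) × AtLeast (suc n) (Counted S x ω ψ)))

  ClashFree : State → Set
  ClashFree S = ¬ Clash S

  AllRunsFinite : Fm → Set₁
  AllRunsFinite φ = ¬ (Σ (ℕ → State) λ s → (s 0 ≡ initial φ) × (∀ i → Step (s i) (s (suc i))))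

  SomeRunSucceeds : Fm → Set₁
  SomeRunSucceeds φ = ∃[ S ] (Star Step (initial φ) S × Complete S × ClashFree S)

-- Every variable x carries a potential: the number of formulas of the finite closure of φ
-- not yet labelling x, weighted so heavily that one new label outweighs any change in the numbers of
-- ⟨ω⟩≥n-successors x still lacks. Each rule lowers the potential of the variable it acts on and raises no
-- potential at the same or a smaller depth in the ≺-tree; the choose-rule may delete the subtree below its
-- variable, but that only affects deeper levels. Hence the vector of total potentials per depth
-- 0, …, md φ decreases lexicographically.
--
-- A complete clash-free system describes a model of its own labels, its variables being the worlds.
--
-- Conversely, a model of φ guides the non-deterministic choices so that the system stays embedded in it:
-- labels hold at the images of their variables, distinct successors of a variable have distinct images,
-- and edges are saturated with respect to the finitely many relation literals of φ. Such a system has no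
-- clash, and by termination the guided run stops at a complete one.

{-# OPTIONS --safe #-}
module Submission where

open import Defs
open import Level using (0ℓ)
open import Data.Product using (_×_; Σ; _,_; proj₁; proj₂; ∃-syntax)
open import Function.Bundles using (_⇔_; mk⇔)
open import Axiom.ExcludedMiddle using (ExcludedMiddle)

open import Axiom.DoubleNegationElimination using (em⇒dne)
open import Data.Bool using (Bool; true; false)
open import Data.Empty using (⊥-elim)
open import Data.Fin using (Fin; zero; suc; toℕ)
open import Data.List using (List; []; _∷_; _++_; map; concatMap; length; filter)
open import Data.List.Membership.Propositional using (_∈_; find; lose)
open import Data.List.Membership.Propositional.Properties
  using (∈-++⁺ˡ; ∈-++⁺ʳ; ∈-++⁻; ∈-map⁺; ∈-map⁻; ∈-concatMap⁺; ∈-concatMap⁻; ∈-filter⁺; ∈-filter⁻)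
open import Data.List.NonEmpty using (_∷_; toList)
open import Data.List.Relation.Unary.All as All using (All)
open import Data.List.Relation.Unary.Any using (here; there)
open import Data.Nat using (ℕ; zero; suc; _+_; _*_; _∸_; _≤_; _<_; _≟_; _⊔_; z≤n; s≤s; z<s)
open import Data.Nat.Induction using (<-wellFounded)
open import Data.Nat.Properties
open import Data.Sum using (_⊎_; inj₁; inj₂; [_,_]′)
import Data.Sum as Sum
open import Data.Vec using (Vec; tabulate)
import Data.Vec.Functional as Vector
import Data.Vec.Relation.Binary.Lex.Strict as Lex
open import Function using (_∘_)
open import Function.Definitions using (Injective)
open import Induction.InfiniteDescent using (InfiniteDescendingSequence; Descent; descent∧wf⇒empty)
open import Induction.WellFounded using (WellFounded)
open import Relation.Binary.Construct.Closure.ReflexiveTransitive using (Star; ε; _◅_; _◅◅_)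
open import Relation.Binary.Construct.Closure.Transitive using (TransClosure; [_]; _∷_; _∷ʳ_)
open import Relation.Binary.PropositionalEquality
  using (_≡_; _≢_; refl; sym; trans; cong; cong₂; subst; subst₂; module ≡-Reasoning)
open import Relation.Nullary using (¬_; Dec; yes; no; does)

module _ {A : Set} where

  AtLeast-zero : {P : A → Set} → AtLeast 0 P
  AtLeast-zero = (λ ()) , (λ { {()} }) , (λ ())

  AtLeast-map : ∀ {P Q : A → Set} {n} → (∀ u → P u → Q u) → AtLeast n P → AtLeast n Q
  AtLeast-map P⊆Q (f , f-inj , Pf) = f , f-inj , λ i → P⊆Q (f i) (Pf i)

  AtLeast-suc : ∀ {P Q : A → Set} {n y} → (∀ u → P u → Q u) → AtLeast n P → Q y → ¬ P y →
                AtLeast (suc n) Q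
  AtLeast-suc {P} {Q} {y = y} P⊆Q (f , f-inj , Pf) Qy ¬Py = y Vector.∷ f , inj , Q-y∷f
    where
    inj : ∀ {i j} → (y Vector.∷ f) i ≡ (y Vector.∷ f) j → i ≡ j
    inj {zero}  {zero}  _ = refl
    inj {zero}  {suc j} e = ⊥-elim (¬Py (subst P (sym e) (Pf j)))
    inj {suc i} {zero}  e = ⊥-elim (¬Py (subst P e (Pf i)))
    inj {suc i} {suc j} e = cong suc (f-inj e)
    Q-y∷f : ∀ i → Q ((y Vector.∷ f) i)
    Q-y∷f zero    = Qy
    Q-y∷f (suc i) = P⊆Q (f i) (Pf i)

  ∑ : List A → (A → ℕ) → ℕ
  ∑ []       f = 0
  ∑ (a ∷ as) f = f a + ∑ as f

  ∑-mono-≤ : ∀ xs {f g : A → ℕ} → (∀ a → f a ≤ g a) → ∑ xs f ≤ ∑ xs g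
  ∑-mono-≤ []       f≤g = z≤n
  ∑-mono-≤ (a ∷ xs) f≤g = +-mono-≤ (f≤g a) (∑-mono-≤ xs f≤g)

  ∑-mono-< : ∀ {xs t} {f g : A → ℕ} → t ∈ xs → (∀ a → f a ≤ g a) → f t < g t → ∑ xs f < ∑ xs g
  ∑-mono-< {a ∷ xs} (here refl) f≤g ft<gt = +-mono-<-≤ ft<gt (∑-mono-≤ xs f≤g)
  ∑-mono-< {a ∷ xs} (there t∈) f≤g ft<gt = +-mono-≤-< (f≤g a) (∑-mono-< t∈ f≤g ft<gt)

  ∑-≤-length : ∀ xs {f : A → ℕ} → (∀ a → f a ≤ 1) → ∑ xs f ≤ length xs
  ∑-≤-length []       f≤1 = z≤n
  ∑-≤-length (a ∷ xs) f≤1 = +-mono-≤ (f≤1 a) (∑-≤-length xs f≤1)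

∑< : ℕ → (ℕ → ℕ) → ℕ
∑< zero    f = 0
∑< (suc n) f = ∑< n f + f n

∑<-mono-≤ : ∀ n {f g} → (∀ v → v < n → f v ≤ g v) → ∑< n f ≤ ∑< n g
∑<-mono-≤ zero    f≤g = z≤n
∑<-mono-≤ (suc n) f≤g = +-mono-≤ (∑<-mono-≤ n (λ v v<n → f≤g v (m≤n⇒m≤1+n v<n))) (f≤g n ≤-refl)

∑<-mono-< : ∀ n {f g t} → t < n → (∀ v → v < n → f v ≤ g v) → f t < g t → ∑< n f < ∑< n g
∑<-mono-< (suc n) t<1+n f≤g ft<gt with m≤n⇒m<n∨m≡n (≤-pred t<1+n)
... | inj₁ t<n = +-mono-<-≤ (∑<-mono-< n t<n (λ v v<n → f≤g v (m≤n⇒m≤1+n v<n)) ft<gt) (f≤g n ≤-refl)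
... | inj₂ refl = +-mono-≤-< (∑<-mono-≤ n (λ v v<n → f≤g v (m≤n⇒m≤1+n v<n))) ft<gt

∑<-vanishing : ∀ {m n f} → m ≤ n → (∀ v → m ≤ v → f v ≡ 0) → ∑< n f ≡ ∑< m f
∑<-vanishing {n = zero}  z≤n      f≥m≡0 = refl
∑<-vanishing {m} {suc n} {f} m≤1+n f≥m≡0 with m≤n⇒m<n∨m≡n m≤1+n
... | inj₂ refl = refl
... | inj₁ m<1+n = begin
  ∑< n f + f n ≡⟨ cong₂ _+_ (∑<-vanishing (≤-pred m<1+n) f≥m≡0) (f≥m≡0 n (≤-pred m<1+n)) ⟩
  ∑< m f + 0   ≡⟨ +-identityʳ _ ⟩
  ∑< m f       ∎
  where open ≡-Reasoning

_<ₗₑₓ_ : ∀ {n} → Vec ℕ n → Vec ℕ n → Set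
_<ₗₑₓ_ = Lex.Lex-< _≡_ _<_

<ₗₑₓ-wellFounded : ∀ {n} → WellFounded (_<ₗₑₓ_ {n})
<ₗₑₓ-wellFounded = Lex.<-wellFounded trans (proj₁ <-resp₂-≡) <-wellFounded

tabulate-<ₗₑₓ : ∀ {n} {f g : ℕ → ℕ} k → k < n → (∀ d → d < k → f d ≤ g d) → f k < g k →
                tabulate {n = n} (f ∘ toℕ) <ₗₑₓ tabulate (g ∘ toℕ)
tabulate-<ₗₑₓ {suc n} zero    _         _      fk<gk = Lex.this fk<gk refl
tabulate-<ₗₑₓ {suc n} (suc k) (s≤s k<n) f≤g fk<gk with m≤n⇒m<n∨m≡n (f≤g 0 z<s)
... | inj₁ f0<g0 = Lex.this f0<g0 refl
... | inj₂ f0≡g0 = Lex.next f0≡g0 (tabulate-<ₗₑₓ k k<n (λ d d<k → f≤g (suc d) (s≤s d<k)) fk<gk)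

wellFounded⇒noInfiniteDescent : ∀ {B : Set} {_≺_ : B → B → Set} → WellFounded _≺_ →
                                ∀ f → ¬ InfiniteDescendingSequence _≺_ f
wellFounded⇒noInfiniteDescent {_≺_ = _≺_} wf f desc = descent∧wf⇒empty descent wf (f 0) (f , refl , desc)
  where
  descent : Descent _≺_ (λ x → ∃[ f ] (f 0 ≡ x × InfiniteDescendingSequence _≺_ f))
  descent (f , refl , desc) = f 1 , desc 0 , f ∘ suc , refl , desc ∘ suc

TransClosure-unsnoc : ∀ {B : Set} {R : B → B → Set} {a c} → TransClosure R a c →
                      R a c ⊎ ∃[ b ] (TransClosure R a b × R b c)
TransClosure-unsnoc [ r ] = inj₁ r
TransClosure-unsnoc (r ∷ t) with TransClosure-unsnoc t
... | inj₁ r′ = inj₂ (_ , [ r ] , r′)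
... | inj₂ (b , t′ , r′) = inj₂ (b , r ∷ t′ , r′)

_[_↦_] : {B : Set} → (ℕ → B) → ℕ → B → ℕ → B
(f [ y ↦ b ]) v with v ≟ y
... | yes _ = b
... | no  _ = f v

[↦]-same : ∀ {B : Set} (f : ℕ → B) y b → (f [ y ↦ b ]) y ≡ b
[↦]-same f y b with y ≟ y
... | yes _  = refl
... | no y≢y = ⊥-elim (y≢y refl)

[↦]-other : ∀ {B : Set} (f : ℕ → B) {y} b {v} → v ≢ y → (f [ y ↦ b ]) v ≡ f v
[↦]-other f {y} b {v} v≢y with v ≟ y
... | yes v≡y = ⊥-elim (v≢y v≡y)
... | no  _   = refl

module Closure {Atom RName : Set} (p₀ : Atom) where
  open Gr Atom RName p₀

  ⊥ᶠ : Fm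
  ⊥ᶠ = var p₀ ∧′ nvar p₀

  modalDepth : Fm → ℕ
  modalDepth (var p)      = 0
  modalDepth (nvar p)     = 0
  modalDepth (a ∧′ b)     = modalDepth a ⊔ modalDepth b
  modalDepth (a ∨′ b)     = modalDepth a ⊔ modalDepth b
  modalDepth (dia≥ ω n a) = suc (modalDepth a)
  modalDepth (dia≤ ω n a) = suc (modalDepth a)

  modalDepth-∼ : ∀ ψ → modalDepth (∼ ψ) ≤ modalDepth ψ
  modalDepth-∼ (var p)            = z≤n
  modalDepth-∼ (nvar p)           = z≤n
  modalDepth-∼ (a ∧′ b)           = ⊔-mono-≤ (modalDepth-∼ a) (modalDepth-∼ b)
  modalDepth-∼ (a ∨′ b)           = ⊔-mono-≤ (modalDepth-∼ a) (modalDepth-∼ b)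
  modalDepth-∼ (dia≥ ω zero a)    = z≤n
  modalDepth-∼ (dia≥ ω (suc n) a) = ≤-refl
  modalDepth-∼ (dia≤ ω n a)       = ≤-refl

  modalDepth-pick : ∀ b ψ → modalDepth (pick b ψ) ≤ modalDepth ψ
  modalDepth-pick true  ψ = ≤-refl
  modalDepth-pick false ψ = modalDepth-∼ ψ

  ∼∼∼≡∼ : ∀ ψ → ∼ (∼ (∼ ψ)) ≡ ∼ ψ
  ∼∼∼≡∼ (var p)            = refl
  ∼∼∼≡∼ (nvar p)           = refl
  ∼∼∼≡∼ (a ∧′ b)           = cong₂ _∨′_ (∼∼∼≡∼ a) (∼∼∼≡∼ b)
  ∼∼∼≡∼ (a ∨′ b)           = cong₂ _∧′_ (∼∼∼≡∼ a) (∼∼∼≡∼ b)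
  ∼∼∼≡∼ (dia≥ ω zero a)    = refl
  ∼∼∼≡∼ (dia≥ ω (suc n) a) = refl
  ∼∼∼≡∼ (dia≤ ω n a)       = refl

  components : Fm → List Fm
  components (var p)      = []
  components (nvar p)     = []
  components (a ∧′ b)     = a ∷ b ∷ []
  components (a ∨′ b)     = a ∷ b ∷ []
  components (dia≥ ω n a) = a ∷ []
  components (dia≤ ω n a) = a ∷ []

  subformulas properSubformulas : Fm → List Fm
  subformulas ψ = ψ ∷ properSubformulas ψ
  properSubformulas (var p)      = []
  properSubformulas (nvar p)     = []
  properSubformulas (a ∧′ b)     = subformulas a ++ subformulas b
  properSubformulas (a ∨′ b)     = subformulas a ++ subformulas b
  properSubformulas (dia≥ ω n a) = subformulas a
  properSubformulas (dia≤ ω n a) = subformulas a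

  subformulas-trans : ∀ φ {ψ χ} → ψ ∈ subformulas φ → χ ∈ subformulas ψ → χ ∈ subformulas φ
  subformulas-trans φ            (here refl) χ∈ψ = χ∈ψ
  subformulas-trans (a ∧′ b)     (there ψ∈) χ∈ψ with ∈-++⁻ (subformulas a) ψ∈
  ... | inj₁ ψ∈a = there (∈-++⁺ˡ (subformulas-trans a ψ∈a χ∈ψ))
  ... | inj₂ ψ∈b = there (∈-++⁺ʳ (subformulas a) (subformulas-trans b ψ∈b χ∈ψ))
  subformulas-trans (a ∨′ b)     (there ψ∈) χ∈ψ with ∈-++⁻ (subformulas a) ψ∈
  ... | inj₁ ψ∈a = there (∈-++⁺ˡ (subformulas-trans a ψ∈a χ∈ψ))
  ... | inj₂ ψ∈b = there (∈-++⁺ʳ (subformulas a) (subformulas-trans b ψ∈b χ∈ψ))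
  subformulas-trans (dia≥ ω n a) (there ψ∈) χ∈ψ = there (subformulas-trans a ψ∈ χ∈ψ)
  subformulas-trans (dia≤ ω n a) (there ψ∈) χ∈ψ = there (subformulas-trans a ψ∈ χ∈ψ)

  components⊆subformulas : ∀ ψ {c} → c ∈ components ψ → c ∈ subformulas ψ
  components⊆subformulas (a ∧′ b)     (here refl)         = there (∈-++⁺ˡ {xs = subformulas a} (here refl))
  components⊆subformulas (a ∧′ b)     (there (here refl)) = there (∈-++⁺ʳ (subformulas a) (here refl))
  components⊆subformulas (a ∨′ b)     (here refl)         = there (∈-++⁺ˡ {xs = subformulas a} (here refl))
  components⊆subformulas (a ∨′ b)     (there (here refl)) = there (∈-++⁺ʳ (subformulas a) (here refl))
  components⊆subformulas (dia≥ ω n a) (here refl)         = there (here refl)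
  components⊆subformulas (dia≤ ω n a) (here refl)         = there (here refl)

  modalDepth-components : ∀ χ {c} → c ∈ components χ → modalDepth c ≤ modalDepth χ
  modalDepth-components (a ∧′ b)     (here refl)         = m≤m⊔n (modalDepth a) (modalDepth b)
  modalDepth-components (a ∧′ b)     (there (here refl)) = m≤n⊔m (modalDepth a) (modalDepth b)
  modalDepth-components (a ∨′ b)     (here refl)         = m≤m⊔n (modalDepth a) (modalDepth b)
  modalDepth-components (a ∨′ b)     (there (here refl)) = m≤n⊔m (modalDepth a) (modalDepth b)
  modalDepth-components (dia≥ ω n a) (here refl)         = n≤1+n (modalDepth a)
  modalDepth-components (dia≤ ω n a) (here refl)         = n≤1+n (modalDepth a)

  disjunct∈ : ∀ {a b χ} → χ ≡ a ⊎ χ ≡ b → χ ∈ components (a ∨′ b)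
  disjunct∈ (inj₁ refl) = here refl
  disjunct∈ (inj₂ refl) = there (here refl)

  base : Fm → List Fm
  base φ = subformulas φ ++ subformulas ⊥ᶠ

  base-components : ∀ φ {ψ c} → ψ ∈ base φ → c ∈ components ψ → c ∈ base φ
  base-components φ {ψ} ψ∈ c∈ with ∈-++⁻ (subformulas φ) ψ∈
  ... | inj₁ ψ∈φ = ∈-++⁺ˡ (subformulas-trans φ ψ∈φ (components⊆subformulas ψ c∈))
  ... | inj₂ ψ∈⊥ = ∈-++⁺ʳ (subformulas φ) (subformulas-trans ⊥ᶠ ψ∈⊥ (components⊆subformulas ψ c∈))

  -- ∼ is not an involution (∼∼ ⟨ω⟩≥0 ψ is ¬p₀ ∨ p₀), but it is one on ∼-images.
  orbit : Fm → List Fm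
  orbit ψ = ψ ∷ ∼ ψ ∷ ∼ (∼ ψ) ∷ []

  orbit-∼ : ∀ {ψ χ} → χ ∈ orbit ψ → ∼ χ ∈ orbit ψ
  orbit-∼     (here refl)                 = there (here refl)
  orbit-∼     (there (here refl))         = there (there (here refl))
  orbit-∼ {ψ} (there (there (here refl))) = there (here (∼∼∼≡∼ ψ))

  orbit-trans : ∀ {ψ χ c} → χ ∈ orbit ψ → c ∈ orbit χ → c ∈ orbit ψ
  orbit-trans χ∈ (here refl)                 = χ∈
  orbit-trans χ∈ (there (here refl))         = orbit-∼ χ∈
  orbit-trans χ∈ (there (there (here refl))) = orbit-∼ (orbit-∼ χ∈)

  ComponentOrbit : Fm → Fm → Set
  ComponentOrbit ψ c = ∃[ c′ ] (c′ ∈ components ψ ++ subformulas ⊥ᶠ × c ∈ orbit c′)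

  components-∼ : ∀ ψ {c} → c ∈ components (∼ ψ) → ComponentOrbit ψ c
  components-∼ (a ∧′ b)           (here refl)         = a , here refl , there (here refl)
  components-∼ (a ∧′ b)           (there (here refl)) = b , there (here refl) , there (here refl)
  components-∼ (a ∨′ b)           (here refl)         = a , here refl , there (here refl)
  components-∼ (a ∨′ b)           (there (here refl)) = b , there (here refl) , there (here refl)
  components-∼ (dia≥ ω zero a)    (here refl)         = var p₀ , there (there (here refl)) , here refl
  components-∼ (dia≥ ω zero a)    (there (here refl)) = nvar p₀ , there (there (there (here refl))) , here refl
  components-∼ (dia≥ ω (suc n) a) (here refl)         = a , here refl , here refl
  components-∼ (dia≤ ω n a)       (here refl)         = a , here refl , here refl

  components-orbit : ∀ {ψ χ c} → χ ∈ orbit ψ → c ∈ components χ → ComponentOrbit ψ c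
  components-orbit (here refl) c∈ = _ , ∈-++⁺ˡ c∈ , here refl
  components-orbit {ψ} (there (here refl)) c∈ = components-∼ ψ c∈
  components-orbit {ψ} (there (there (here refl))) c∈ with components-∼ (∼ ψ) c∈
  ... | c″ , c″∈ , c∈c″ with ∈-++⁻ (components (∼ ψ)) c″∈
  ...   | inj₂ c″∈⊥ = c″ , ∈-++⁺ʳ (components ψ) c″∈⊥ , c∈c″
  ...   | inj₁ c″∈∼ψ with components-∼ ψ c″∈∼ψ
  ...     | c′ , c′∈ , c″∈c′ = c′ , c′∈ , orbit-trans c″∈c′ c∈c″

  closure : Fm → List Fm
  closure φ = concatMap orbit (base φ)

  ∈closure : ∀ {φ ψ χ} → ψ ∈ base φ → χ ∈ orbit ψ → χ ∈ closure φ
  ∈closure ψ∈ χ∈ = ∈-concatMap⁺ orbit (lose ψ∈ χ∈)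

  ∈closure⁻ : ∀ {φ χ} → χ ∈ closure φ → ∃[ ψ ] (ψ ∈ base φ × χ ∈ orbit ψ)
  ∈closure⁻ {φ} χ∈ = find (∈-concatMap⁻ orbit {xs = base φ} χ∈)

  closure-self : ∀ φ → φ ∈ closure φ
  closure-self φ = ∈closure (here refl) (here refl)

  closure-∼ : ∀ {φ χ} → χ ∈ closure φ → ∼ χ ∈ closure φ
  closure-∼ χ∈ with ∈closure⁻ χ∈
  ... | ψ , ψ∈ , χ∈ψ = ∈closure ψ∈ (orbit-∼ χ∈ψ)

  closure-components : ∀ {φ χ c} → χ ∈ closure φ → c ∈ components χ → c ∈ closure φ
  closure-components {φ} χ∈ c∈ with ∈closure⁻ χ∈
  ... | ψ , ψ∈ , χ∈ψ with components-orbit χ∈ψ c∈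
  ...   | c′ , c′∈ , c∈c′ with ∈-++⁻ (components ψ) c′∈
  ...     | inj₁ c′∈ψ = ∈closure (base-components φ ψ∈ c′∈ψ) c∈c′
  ...     | inj₂ c′∈⊥ = ∈closure (∈-++⁺ʳ (subformulas φ) c′∈⊥) c∈c′

  closure-pick : ∀ {φ ψ} b → ψ ∈ closure φ → pick b ψ ∈ closure φ
  closure-pick true  ψ∈ = ψ∈
  closure-pick false ψ∈ = closure-∼ ψ∈

  modalRels : Fm → List RelLit
  modalRels (dia≥ ω n a) = toList ω
  modalRels (dia≤ ω n a) = toList ω
  modalRels _            = []

  modalRels-∼ : ∀ ψ {R} → R ∈ modalRels (∼ ψ) → R ∈ modalRels ψ
  modalRels-∼ (dia≥ ω (suc n) a) R∈ = R∈
  modalRels-∼ (dia≤ ω n a)       R∈ = R∈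
  modalRels-∼ (var p)            ()
  modalRels-∼ (nvar p)           ()
  modalRels-∼ (a ∧′ b)           ()
  modalRels-∼ (a ∨′ b)           ()
  modalRels-∼ (dia≥ ω zero a)    ()

  modalRels-orbit : ∀ {ψ χ R} → χ ∈ orbit ψ → R ∈ modalRels χ → R ∈ modalRels ψ
  modalRels-orbit     (here refl)                 R∈ = R∈
  modalRels-orbit {ψ} (there (here refl))         R∈ = modalRels-∼ ψ R∈
  modalRels-orbit {ψ} (there (there (here refl))) R∈ = modalRels-∼ ψ (modalRels-∼ (∼ ψ) R∈)

  ⁻¹-involutive : ∀ R → R ⁻¹ ⁻¹ ≡ R
  ⁻¹-involutive (pos r) = refl
  ⁻¹-involutive (inv r) = refl

  withInverses : List RelLit → List RelLit
  withInverses Rs = Rs ++ map _⁻¹ Rs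

  withInverses-⁻¹ : ∀ Rs {R} → R ∈ withInverses Rs → R ⁻¹ ∈ withInverses Rs
  withInverses-⁻¹ Rs R∈ with ∈-++⁻ Rs R∈
  ... | inj₁ R∈Rs = ∈-++⁺ʳ Rs (∈-map⁺ _⁻¹ R∈Rs)
  ... | inj₂ R∈Rs⁻¹ with ∈-map⁻ _⁻¹ R∈Rs⁻¹
  ...   | R′ , R′∈ , refl = ∈-++⁺ˡ (subst (_∈ Rs) (sym (⁻¹-involutive R′)) R′∈)

  relLits : Fm → List RelLit
  relLits φ = concatMap (withInverses ∘ modalRels) (base φ)

  relLits-⁻¹ : ∀ φ {R} → R ∈ relLits φ → R ⁻¹ ∈ relLits φ
  relLits-⁻¹ φ R∈ with find (∈-concatMap⁻ (withInverses ∘ modalRels) {xs = base φ} R∈)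
  ... | ψ , ψ∈ , R∈ψ = ∈-concatMap⁺ (withInverses ∘ modalRels) (lose ψ∈ (withInverses-⁻¹ (modalRels ψ) R∈ψ))

  modalRels⊆relLits : ∀ {φ χ R} → χ ∈ closure φ → R ∈ modalRels χ → R ∈ relLits φ
  modalRels⊆relLits χ∈ R∈ with ∈closure⁻ χ∈
  ... | ψ , ψ∈ , χ∈ψ = ∈-concatMap⁺ (withInverses ∘ modalRels) (lose ψ∈ (∈-++⁺ˡ (modalRels-orbit χ∈ψ R∈)))

module Reachable {Atom RName : Set} (p₀ : Atom) where
  open Gr Atom RName p₀
  open Closure {Atom} {RName} p₀ using (⁻¹-involutive)

  extend : State → (Con → Set) → State
  extend S New = ⟨ (λ c → cs S c ⊎ New c) , prec S ⟩

  LabelsOf : ℕ → (Con → Set) → Set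
  LabelsOf x New = ∀ {c} → New c → ∃[ ψ ] (c ≡ (x ⊨c ψ))

  record WellFormed (φ : Fm) (S : State) (B : ℕ) : Set where
    field
      mentions<B  : ∀ {c v} → cs S c → Mentions c v → v < B
      prec<B      : ∀ {u v} → prec S u v → u < B × v < B
      edge-sym    : ∀ {R u v} → cs S (edge R u v) → cs S (edge (R ⁻¹) v u)
      root-label  : cs S (0 ⊨c φ)
      root-orphan : ∀ {u} → ¬ prec S u 0
  open WellFormed public

  fresh-bound : ∀ {φ S B} → WellFormed φ S B → Fresh S B
  fresh-bound wf = (λ c c∈ B∈c → <-irrefl refl (mentions<B wf c∈ B∈c))
                 , (λ u u≺B → <-irrefl refl (proj₂ (prec<B wf u≺B)))
                 , (λ u B≺u → <-irrefl refl (proj₁ (prec<B wf B≺u)))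

  no-path-to-root : ∀ {φ S B y} → WellFormed φ S B → ¬ TransClosure (prec S) y 0
  no-path-to-root wf path with TransClosure-unsnoc path
  ... | inj₁ y≺0           = root-orphan wf y≺0
  ... | inj₂ (_ , _ , u≺0) = root-orphan wf u≺0

  initial-wellFormed : ∀ φ → WellFormed φ (initial φ) 1
  initial-wellFormed φ = record
    { mentions<B = λ { refl refl → s≤s z≤n } ; prec<B = λ () ; edge-sym = λ ()
    ; root-label = refl ; root-orphan = λ () }

  nextBound : ∀ {S S′} → Step S S′ → ℕ → ℕ
  nextBound (≥-rule _ _ _ _ _ y _ _ _ _ _ _ _) B = suc (B ⊔ y)
  nextBound _                                  B = B

  wellFormed-extend : ∀ {φ S B x ψ New} → WellFormed φ S B → cs S (x ⊨c ψ) → LabelsOf x New →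
                      WellFormed φ (extend S New) B
  wellFormed-extend {S = S} {B} {New = New} wf x∈S labels = record
    { mentions<B = mentions
    ; prec<B = prec<B wf
    ; edge-sym = symmetric
    ; root-label = inj₁ (root-label wf)
    ; root-orphan = root-orphan wf }
    where
    mentions : ∀ {c v} → cs S c ⊎ New c → Mentions c v → v < B
    mentions (inj₁ c∈) m = mentions<B wf c∈ m
    mentions (inj₂ new) m with labels new
    ... | _ , refl = mentions<B wf x∈S m
    symmetric : ∀ {R u v} → cs S (edge R u v) ⊎ New (edge R u v) → cs S (edge (R ⁻¹) v u) ⊎ New (edge (R ⁻¹) v u)
    symmetric (inj₁ e) = inj₁ (edge-sym wf e)
    symmetric (inj₂ new) with labels new
    ... | _ , ()

  prune : State → ℕ → Fm → State
  prune S y χ = ⟨ (λ c → (cs S c × ¬ (∃[ z ] (TransClosure (prec S) y z × Mentions c z))) ⊎ c ≡ (y ⊨c χ))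
                , prec S ⟩

  addSuccessor : State → ℕ → Fm → ℕ → (Fm → Bool) → List RelLit → State
  addSuccessor S x ψ y choice Rs =
    ⟨ (λ c → cs S c
             ⊎ c ≡ (y ⊨c ψ)
             ⊎ (∃[ ψ′ ] ((∃[ σ ] ModalAt S x σ ψ′) × c ≡ (y ⊨c pick (choice ψ′) ψ′)))
             ⊎ (∃[ R ] (R ∈ Rs × (c ≡ edge R x y ⊎ c ≡ edge (R ⁻¹) y x))))
    , (λ u v → prec S u v ⊎ (u ≡ x × v ≡ y)) ⟩

  addSuccessor-edge⁻ : ∀ {S x ψ y choice Rs R u v} → cs (addSuccessor S x ψ y choice Rs) (edge R u v) →
                       cs S (edge R u v) ⊎ (u ≡ x × v ≡ y × R ∈ Rs) ⊎ (u ≡ y × v ≡ x × R ⁻¹ ∈ Rs)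
  addSuccessor-edge⁻ (inj₁ e)                                  = inj₁ e
  addSuccessor-edge⁻ (inj₂ (inj₁ ()))
  addSuccessor-edge⁻ (inj₂ (inj₂ (inj₁ (_ , _ , ()))))
  addSuccessor-edge⁻ (inj₂ (inj₂ (inj₂ (R , R∈ , inj₁ refl)))) = inj₂ (inj₁ (refl , refl , R∈))
  addSuccessor-edge⁻ {Rs = Rs} (inj₂ (inj₂ (inj₂ (R , R∈ , inj₂ refl)))) =
    inj₂ (inj₂ (refl , refl , subst (_∈ Rs) (sym (⁻¹-involutive R)) R∈))

  wellFormed-prune : ∀ {φ S B R x y χ} → WellFormed φ S B → cs S (edge R x y) → WellFormed φ (prune S y χ) B
  wellFormed-prune {S = S} {B} {y = y} {χ} wf xRy = record
    { mentions<B = mentions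
    ; prec<B = prec<B wf
    ; edge-sym = symmetric
    ; root-label = inj₁ (root-label wf , λ { (_ , path , refl) → no-path-to-root wf path })
    ; root-orphan = root-orphan wf }
    where
    mentions : ∀ {c v} → cs (prune S y χ) c → Mentions c v → v < B
    mentions (inj₁ (c∈ , _)) m    = mentions<B wf c∈ m
    mentions (inj₂ refl)     refl = mentions<B wf xRy (inj₂ refl)
    symmetric : ∀ {R u v} → cs (prune S y χ) (edge R u v) → cs (prune S y χ) (edge (R ⁻¹) v u)
    symmetric {R} (inj₁ (e , kept)) = inj₁ (edge-sym wf e , λ { (z , path , m) → kept (z , path , swap {R ⁻¹} {R} m) })
      where
      swap : ∀ {R R′ u v z} → Mentions (edge R u v) z → Mentions (edge R′ v u) z
      swap (inj₁ e) = inj₂ e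
      swap (inj₂ e) = inj₁ e
    symmetric (inj₂ ())

  wellFormed-addSuccessor : ∀ {φ S B x ψ y choice Rs χ} → WellFormed φ S B → cs S (x ⊨c χ) → Fresh S y →
                            WellFormed φ (addSuccessor S x ψ y choice Rs) (suc (B ⊔ y))
  wellFormed-addSuccessor {S = S} {B} {x} {ψ} {y} {choice} {Rs} wf x∈S fresh = record
    { mentions<B = mentions
    ; prec<B = precedes
    ; edge-sym = symmetric
    ; root-label = inj₁ (root-label wf)
    ; root-orphan = λ { (inj₁ u≺0) → root-orphan wf u≺0 ; (inj₂ (refl , refl)) → proj₁ fresh _ (root-label wf) refl } }
    where
    S′ = addSuccessor S x ψ y choice Rs
    old : ∀ {v} → v < B → v < suc (B ⊔ y)
    old v<B = <-≤-trans v<B (m≤n⇒m≤1+n (m≤m⊔n B y))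
    x<B′ : x < suc (B ⊔ y)
    x<B′ = old (mentions<B wf x∈S refl)
    y<B′ : y < suc (B ⊔ y)
    y<B′ = s≤s (m≤n⊔m B y)
    mentions : ∀ {c v} → cs S′ c → Mentions c v → v < suc (B ⊔ y)
    mentions (inj₁ c∈)                                 m         = old (mentions<B wf c∈ m)
    mentions (inj₂ (inj₁ refl))                        refl      = y<B′
    mentions (inj₂ (inj₂ (inj₁ (_ , _ , refl))))       refl      = y<B′
    mentions (inj₂ (inj₂ (inj₂ (_ , _ , inj₁ refl)))) (inj₁ refl) = x<B′
    mentions (inj₂ (inj₂ (inj₂ (_ , _ , inj₁ refl)))) (inj₂ refl) = y<B′
    mentions (inj₂ (inj₂ (inj₂ (_ , _ , inj₂ refl)))) (inj₁ refl) = y<B′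
    mentions (inj₂ (inj₂ (inj₂ (_ , _ , inj₂ refl)))) (inj₂ refl) = x<B′
    precedes : ∀ {u v} → prec S′ u v → u < suc (B ⊔ y) × v < suc (B ⊔ y)
    precedes (inj₁ u≺v)          = old (proj₁ (prec<B wf u≺v)) , old (proj₂ (prec<B wf u≺v))
    precedes (inj₂ (refl , refl)) = x<B′ , y<B′
    symmetric : ∀ {R u v} → cs S′ (edge R u v) → cs S′ (edge (R ⁻¹) v u)
    symmetric (inj₁ e)                                  = inj₁ (edge-sym wf e)
    symmetric (inj₂ (inj₁ ()))
    symmetric (inj₂ (inj₂ (inj₁ (_ , _ , ()))))
    symmetric (inj₂ (inj₂ (inj₂ (R , R∈ , inj₁ refl)))) = inj₂ (inj₂ (inj₂ (R , R∈ , inj₂ refl)))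
    symmetric (inj₂ (inj₂ (inj₂ (R , R∈ , inj₂ refl)))) =
      inj₂ (inj₂ (inj₂ (R , R∈ , inj₁ (cong (λ Q → edge Q x y) (⁻¹-involutive R)))))

  wellFormed-step : ∀ {φ S S′ B} → WellFormed φ S B → (st : Step S S′) → WellFormed φ S′ (nextBound st B)
  wellFormed-step wf (∧-rule _ _ a b a∧b _) =
    wellFormed-extend wf a∧b λ { (inj₁ refl) → a , refl ; (inj₂ refl) → b , refl }
  wellFormed-step wf (∨-rule _ _ _ _ χ a∨b _ _ _)                   = wellFormed-extend wf a∨b λ { refl → χ , refl }
  wellFormed-step wf (choose-rule _ _ _ _ _ _ (_ , (_ , _ , xRy) , _)) = wellFormed-prune wf xRy
  wellFormed-step wf (≥-rule _ _ _ _ _ _ _ _ ≥∈ _ _ fresh _)          = wellFormed-addSuccessor wf ≥∈ fresh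

  wellFormed-star : ∀ {φ S S′ B} → WellFormed φ S B → Star Step S S′ → ∃[ B′ ] WellFormed φ S′ B′
  wellFormed-star wf ε          = _ , wf
  wellFormed-star wf (st ◅ run) = wellFormed-star (wellFormed-step wf st) run

module Classical (lem : ExcludedMiddle 0ℓ) where

  dne : ∀ {P : Set} → ¬ ¬ P → P
  dne = em⇒dne lem

  𝟙 : Set → ℕ
  𝟙 P with lem {P}
  ... | yes _ = 1
  ... | no  _ = 0

  𝟙-yes : ∀ {P} → P → 𝟙 P ≡ 1
  𝟙-yes {P} p with lem {P}
  ... | yes _ = refl
  ... | no ¬p = ⊥-elim (¬p p)

  𝟙-no : ∀ {P} → ¬ P → 𝟙 P ≡ 0
  𝟙-no {P} ¬p with lem {P}
  ... | yes p = ⊥-elim (¬p p)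
  ... | no  _ = refl

  𝟙-≤1 : ∀ P → 𝟙 P ≤ 1
  𝟙-≤1 P with lem {P}
  ... | yes _ = ≤-refl
  ... | no  _ = z≤n

  𝟙-mono : ∀ {P Q} → (P → Q) → 𝟙 P ≤ 𝟙 Q
  𝟙-mono {P} {Q} P→Q with lem {P} | lem {Q}
  ... | yes _ | yes _ = ≤-refl
  ... | yes p | no ¬q = ⊥-elim (¬q (P→Q p))
  ... | no  _ | _     = z≤n

  𝟙-< : ∀ {P Q} → ¬ P → Q → 𝟙 P < 𝟙 Q
  𝟙-< ¬p q = subst₂ _<_ (sym (𝟙-no ¬p)) (sym (𝟙-yes q)) z<s

  -- min (|P|, n)
  countUpTo : ∀ {A : Set} → ℕ → (A → Set) → ℕ
  countUpTo zero    P = 0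
  countUpTo (suc n) P = countUpTo n P + 𝟙 (AtLeast (suc n) P)

  module _ {A : Set} where

    countUpTo-≤ : ∀ n (P : A → Set) → countUpTo n P ≤ n
    countUpTo-≤ zero    P = z≤n
    countUpTo-≤ (suc n) P = ≤-trans (+-mono-≤ (countUpTo-≤ n P) (𝟙-≤1 _)) (≤-reflexive (+-comm n 1))

    countUpTo-mono : ∀ n {P Q : A → Set} → (∀ u → P u → Q u) → countUpTo n P ≤ countUpTo n Q
    countUpTo-mono zero    P⊆Q = z≤n
    countUpTo-mono (suc n) P⊆Q = +-mono-≤ (countUpTo-mono n P⊆Q) (𝟙-mono (AtLeast-map P⊆Q))

    countUpTo-< : ∀ n {P Q : A → Set} {y} → ¬ AtLeast n P → (∀ u → P u → Q u) → Q y → ¬ P y →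
                  countUpTo n P < countUpTo n Q
    countUpTo-< zero {P} few _ _ _ = ⊥-elim (few (AtLeast-zero {P = P}))
    countUpTo-< (suc n) {P} {Q} few P⊆Q Qy ¬Py with lem {AtLeast n P}
    ... | no fewer = +-mono-<-≤ (countUpTo-< n fewer P⊆Q Qy ¬Py) (𝟙-mono (AtLeast-map P⊆Q))
    ... | yes n-many = begin-strict
      countUpTo n P + 𝟙 (AtLeast (suc n) P) <⟨ +-mono-≤-< (countUpTo-mono n P⊆Q) (𝟙-< few (AtLeast-suc P⊆Q n-many Qy ¬Py)) ⟩
      countUpTo n Q + 𝟙 (AtLeast (suc n) Q) ∎
      where open ≤-Reasoning

  missed-witness : ∀ {A W : Set} {P : A → Set} {n} (π : A → W) (f : Fin n → W) → Injective _≡_ _≡_ f →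
                   ¬ AtLeast n P → ∃[ i ] (∀ {y} → P y → π y ≢ f i)
  missed-witness {P = P} {n} π f f-inj few = dne λ none → few (witnesses none)
    where
    witnesses : ¬ (∃[ i ] (∀ {y} → P y → π y ≢ f i)) → AtLeast n P
    witnesses none = proj₁ ∘ hit
                   , (λ {i} {j} e → f-inj (trans (sym (image i)) (trans (cong π e) (image j))))
                   , proj₁ ∘ proj₂ ∘ hit
      where
      hit : ∀ i → ∃[ y ] (P y × π y ≡ f i)
      hit i = dne λ miss → none (i , λ Py πy≡fi → miss (_ , Py , πy≡fi))
      image : ∀ i → π (proj₁ (hit i)) ≡ f i
      image i = proj₂ (proj₂ (hit i))

module Semantics (lem : ExcludedMiddle 0ℓ) {Atom RName : Set} (p₀ : Atom) (M : Gr.Model Atom RName p₀) where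
  open Gr Atom RName p₀
  open Model M
  open Classical lem

  ⊨∼⇒⊭ : ∀ ψ {w} → _⊨_ M w (∼ ψ) → ¬ _⊨_ M w ψ
  ⊨∼⇒⊭ (var q)            ¬v         v          = ¬v v
  ⊨∼⇒⊭ (nvar q)           v          ¬v         = ¬v v
  ⊨∼⇒⊭ (a ∧′ b)           (inj₁ ∼a)  (a′ , _)   = ⊨∼⇒⊭ a ∼a a′
  ⊨∼⇒⊭ (a ∧′ b)           (inj₂ ∼b)  (_ , b′)   = ⊨∼⇒⊭ b ∼b b′
  ⊨∼⇒⊭ (a ∨′ b)           (∼a , _)   (inj₁ a′)  = ⊨∼⇒⊭ a ∼a a′
  ⊨∼⇒⊭ (a ∨′ b)           (_ , ∼b)   (inj₂ b′)  = ⊨∼⇒⊭ b ∼b b′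
  ⊨∼⇒⊭ (dia≥ ω zero a)    (v , ¬v)   _          = ¬v v
  ⊨∼⇒⊭ (dia≥ ω (suc n) a) few        many       = few many
  ⊨∼⇒⊭ (dia≤ ω n a)       many       few        = few many

  ⊭⇒⊨∼ : ∀ ψ {w} → ¬ _⊨_ M w ψ → _⊨_ M w (∼ ψ)
  ⊭⇒⊨∼ (var p)            ⊭ = ⊭
  ⊭⇒⊨∼ (nvar p)           ⊭ = dne ⊭
  ⊭⇒⊨∼ (a ∧′ b) {w}       ⊭ with lem {_⊨_ M w a}
  ... | yes a′ = inj₂ (⊭⇒⊨∼ b (λ b′ → ⊭ (a′ , b′)))
  ... | no ¬a  = inj₁ (⊭⇒⊨∼ a ¬a)
  ⊭⇒⊨∼ (a ∨′ b)           ⊭ = ⊭⇒⊨∼ a (⊭ ∘ inj₁) , ⊭⇒⊨∼ b (⊭ ∘ inj₂)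
  ⊭⇒⊨∼ (dia≥ ω zero a) {w} ⊭ = ⊥-elim (⊭ (AtLeast-zero {P = λ y → Succ M ω w y × _⊨_ M y a}))
  ⊭⇒⊨∼ (dia≥ ω (suc n) a) ⊭ = ⊭
  ⊭⇒⊨∼ (dia≤ ω n a)       ⊭ = dne ⊭

  ⊨-pick-does : ∀ ψ w → _⊨_ M w (pick (does (lem {_⊨_ M w ψ})) ψ)
  ⊨-pick-does ψ w with lem {_⊨_ M w ψ}
  ... | yes ⊨ψ = ⊨ψ
  ... | no  ⊭ψ = ⊭⇒⊨∼ ψ ⊭ψ

  relSem-⁻¹⁺ : ∀ R {a b} → relSem M R b a → relSem M (R ⁻¹) a b
  relSem-⁻¹⁺ (pos r) bRa = bRa
  relSem-⁻¹⁺ (inv r) bRa = bRa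

  relSem-⁻¹⁻ : ∀ R {a b} → relSem M (R ⁻¹) a b → relSem M R b a
  relSem-⁻¹⁻ (pos r) aR⁻¹b = aR⁻¹b
  relSem-⁻¹⁻ (inv r) aR⁻¹b = aR⁻¹b

module CanonicalModel (lem : ExcludedMiddle 0ℓ) {Atom RName : Set} (p₀ : Atom) where
  open Gr Atom RName p₀
  open Reachable {Atom} {RName} p₀
  open Classical lem

  module _ {φ S B} (wf : WellFormed φ S B) (complete : Complete S) (clashFree : ClashFree S) where

    canonical : Model
    canonical = record { W = ℕ ; rel = λ r x y → cs S (edge (pos r) x y) ; val = λ p x → cs S (x ⊨c var p) }

    open Semantics lem p₀ canonical

    _⊩_ : ℕ → Fm → Set
    x ⊩ ψ = _⊨_ canonical x ψ

    relSem⇒edge : ∀ R {x y} → relSem canonical R x y → cs S (edge R x y)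
    relSem⇒edge (pos r) xRy = xRy
    relSem⇒edge (inv r) yRx = edge-sym wf yRx

    edge⇒relSem : ∀ R {x y} → cs S (edge R x y) → relSem canonical R x y
    edge⇒relSem (pos r) xRy   = xRy
    edge⇒relSem (inv r) xR⁻¹y = edge-sym wf xR⁻¹y

    ∧-saturated : ∀ {x a b} → cs S (x ⊨c (a ∧′ b)) → cs S (x ⊨c a) × cs S (x ⊨c b)
    ∧-saturated a∧b = dne (λ missing → complete _ (∧-rule S _ _ _ a∧b missing))

    ∨-saturated : ∀ {x a b} → cs S (x ⊨c (a ∨′ b)) → cs S (x ⊨c a) ⊎ cs S (x ⊨c b)
    ∨-saturated {x} {a} {b} a∨b with lem {cs S (x ⊨c a)} | lem {cs S (x ⊨c b)}
    ... | yes a∈ | _      = inj₁ a∈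
    ... | no _   | yes b∈ = inj₂ b∈
    ... | no a∉  | no b∉  = ⊥-elim (complete _ (∨-rule S x a b a a∨b a∉ b∉ (inj₁ refl)))

    noLocalRule : ∀ x → NoLocalRule S x
    noLocalRule x = (λ { (a , b , a∧b , missing) → complete _ (∧-rule S x a b a∧b missing) })
                  , (λ { (a , b , a∨b , a∉ , b∉) → complete _ (∨-rule S x a b a a∨b a∉ b∉ (inj₁ refl)) })
                  , (λ ω ψ y applicable → complete _ (choose-rule S x ω ψ y true applicable))

    ≥-saturated : ∀ {x ω n χ} → (∀ {y} → cs S (y ⊨c χ) → y ⊩ χ) → cs S (x ⊨c dia≥ ω n χ) → x ⊩ dia≥ ω n χ
    ≥-saturated {x} {ω} {n} {χ} truth ≥∈ = AtLeast-map Counted⇒⊩ (dne enough)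
      where
      enough : ¬ ¬ AtLeast n (Counted S x ω χ)
      enough few = complete _ (≥-rule S x ω n χ B (λ _ → true) (toList ω) ≥∈ few (noLocalRule x)
                                    (fresh-bound wf) (All.tabulate (λ R∈ → R∈)))
      Counted⇒⊩ : ∀ y → Counted S x ω χ y → Succ canonical ω x y × y ⊩ χ
      Counted⇒⊩ y (edges , χ∈) = All.map (λ {R} → edge⇒relSem R) edges , truth χ∈

    -- A successor satisfying χ carries the label χ: otherwise the choose-rule would still apply.
    ≤-saturated : ∀ {x ω n χ} → (∀ {y} → cs S (y ⊨c (∼ χ)) → y ⊩ (∼ χ)) →
                  cs S (x ⊨c dia≤ ω n χ) → x ⊩ dia≤ ω n χ
    ≤-saturated {x} {ω@(R₀ ∷ _)} {n} {χ} truth∼ ≤∈ many =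
      clashFree (inj₂ (x , ω , n , χ , ≤∈ , AtLeast-map ⊩⇒Counted many))
      where
      ⊩⇒Counted : ∀ y → Succ canonical ω x y × y ⊩ χ → Counted S x ω χ y
      ⊩⇒Counted y (succ , ⊩χ) =
        All.map (λ {R} → relSem⇒edge R) succ
        , dne (λ χ∉ → complete _ (choose-rule S x ω χ y true
                ((n , inj₂ ≤∈) , (R₀ , here refl , relSem⇒edge R₀ (All.head succ)) , χ∉
                , (λ ∼χ∈ → ⊨∼⇒⊭ χ (truth∼ ∼χ∈) ⊩χ))))

    truth-lemma : ∀ ψ {x} → (cs S (x ⊨c ψ) → x ⊩ ψ) × (cs S (x ⊨c (∼ ψ)) → x ⊩ (∼ ψ))
    truth-lemma (var p)  = (λ v → v) , (λ ¬v v → clashFree (inj₁ (_ , p , v , ¬v)))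
    truth-lemma (nvar p) = (λ ¬v v → clashFree (inj₁ (_ , p , v , ¬v))) , (λ v → v)
    truth-lemma (a ∧′ b) =
      (λ a∧b → let a∈ , b∈ = ∧-saturated a∧b in proj₁ (truth-lemma a) a∈ , proj₁ (truth-lemma b) b∈)
      , (λ ∼a∨∼b → Sum.map (proj₂ (truth-lemma a)) (proj₂ (truth-lemma b)) (∨-saturated ∼a∨∼b))
    truth-lemma (a ∨′ b) =
      (λ a∨b → Sum.map (proj₁ (truth-lemma a)) (proj₁ (truth-lemma b)) (∨-saturated a∨b))
      , (λ ∼a∧∼b → let ∼a∈ , ∼b∈ = ∧-saturated ∼a∧∼b in
                    proj₂ (truth-lemma a) ∼a∈ , proj₂ (truth-lemma b) ∼b∈)
    truth-lemma (dia≥ ω zero χ) =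
      ≥-saturated (proj₁ (truth-lemma χ))
      , (λ ⊥∈ → let v , ¬v = ∧-saturated ⊥∈ in ⊥-elim (clashFree (inj₁ (_ , p₀ , v , ¬v))))
    truth-lemma (dia≥ ω (suc n) χ) = ≥-saturated (proj₁ (truth-lemma χ)) , ≤-saturated (proj₂ (truth-lemma χ))
    truth-lemma (dia≤ ω n χ)       = ≤-saturated (proj₂ (truth-lemma χ)) , ≥-saturated (proj₁ (truth-lemma χ))

  succeeds⇒satisfiable : ∀ {φ} → SomeRunSucceeds φ → Satisfiable φ
  succeeds⇒satisfiable {φ} (S , run , complete , clashFree) =
    canonical wf complete clashFree , 0 , proj₁ (truth-lemma wf complete clashFree φ) (root-label wf)
    where wf = proj₂ (wellFormed-star (initial-wellFormed φ) run)

module Termination (lem : ExcludedMiddle 0ℓ) {Atom RName : Set} (p₀ : Atom) (φ : Gr.Fm Atom RName p₀) where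
  open Gr Atom RName p₀
  open Closure {Atom} {RName} p₀
  open Reachable {Atom} {RName} p₀
  open Classical lem

  D C N : ℕ
  D = modalDepth φ
  C = length (closure φ)

  grade : Fm → ℕ
  grade (dia≥ ω n ψ) = n
  grade _            = 0

  N = ∑ (closure φ) grade

  labelled : State → ℕ → Fm → ℕ
  labelled S v χ = 𝟙 (cs S (v ⊨c χ))

  labels : State → ℕ → ℕ
  labels S v = ∑ (closure φ) (labelled S v)

  deficit : State → ℕ → Fm → ℕ
  deficit S v (dia≥ ω n ψ) = n ∸ countUpTo n (Counted S v ω ψ)
  deficit S v _            = 0

  deficits : State → ℕ → ℕ
  deficits S v = ∑ (closure φ) (deficit S v)

  -- Since deficits S v ≤ N, one more label at v outweighs any growth of its deficits.
  potential : State → ℕ → ℕ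
  potential S v = (C ∸ labels S v) * suc N + deficits S v

  labels-≤ : ∀ S v → labels S v ≤ C
  labels-≤ S v = ∑-≤-length (closure φ) (λ χ → 𝟙-≤1 (cs S (v ⊨c χ)))

  deficit-≤-grade : ∀ S v χ → deficit S v χ ≤ grade χ
  deficit-≤-grade S v (var p)      = z≤n
  deficit-≤-grade S v (nvar p)     = z≤n
  deficit-≤-grade S v (a ∧′ b)     = z≤n
  deficit-≤-grade S v (a ∨′ b)     = z≤n
  deficit-≤-grade S v (dia≥ ω n ψ) = m∸n≤m n (countUpTo n (Counted S v ω ψ))
  deficit-≤-grade S v (dia≤ ω n ψ) = z≤n

  deficits-≤ : ∀ S v → deficits S v ≤ N
  deficits-≤ S v = ∑-mono-≤ (closure φ) (deficit-≤-grade S v)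

  weighted-< : ∀ {a a′} x {y} → a < a′ → a′ ≤ C → y ≤ N → (C ∸ a′) * suc N + y < (C ∸ a) * suc N + x
  weighted-< {a} {a′} x {y} a<a′ a′≤C y≤N = begin-strict
    (C ∸ a′) * suc N + y     <⟨ +-monoʳ-< ((C ∸ a′) * suc N) (s≤s y≤N) ⟩
    (C ∸ a′) * suc N + suc N ≡⟨ +-comm ((C ∸ a′) * suc N) (suc N) ⟩
    suc (C ∸ a′) * suc N     ≤⟨ *-monoˡ-≤ (suc N) (∸-monoʳ-< a<a′ a′≤C) ⟩
    (C ∸ a) * suc N          ≤⟨ m≤m+n _ x ⟩
    (C ∸ a) * suc N + x      ∎
    where open ≤-Reasoning

  record Persists (S S′ : State) (v : ℕ) : Set where
    field
      labels-persist  : ∀ {χ} → cs S (v ⊨c χ) → cs S′ (v ⊨c χ)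
      counted-persist : ∀ {ω ψ u} → Counted S v ω ψ u → Counted S′ v ω ψ u
  open Persists

  persists-⊆ : ∀ {S S′ v} → (∀ {c} → cs S c → cs S′ c) → Persists S S′ v
  persists-⊆ S⊆S′ = record
    { labels-persist = S⊆S′
    ; counted-persist = λ (edges , ψ∈) → All.map S⊆S′ edges , S⊆S′ ψ∈ }

  labels-mono : ∀ {S S′ v} → (∀ {χ} → cs S (v ⊨c χ) → cs S′ (v ⊨c χ)) → labels S v ≤ labels S′ v
  labels-mono {S} {S′} {v} keep = ∑-mono-≤ (closure φ) {labelled S v} {labelled S′ v} (λ χ → 𝟙-mono keep)

  deficit-mono : ∀ {S S′ v} → Persists S S′ v → ∀ χ → deficit S′ v χ ≤ deficit S v χ
  deficit-mono P (var p)      = z≤n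
  deficit-mono P (nvar p)     = z≤n
  deficit-mono P (a ∧′ b)     = z≤n
  deficit-mono P (a ∨′ b)     = z≤n
  deficit-mono P (dia≥ ω n ψ) = ∸-monoʳ-≤ n (countUpTo-mono n (λ u → counted-persist P))
  deficit-mono P (dia≤ ω n ψ) = z≤n

  potential-mono : ∀ {S S′ v} → Persists S S′ v → potential S′ v ≤ potential S v
  potential-mono {S} {S′} {v} P =
    +-mono-≤ (*-monoˡ-≤ (suc N) (∸-monoʳ-≤ C (labels-mono {S} {S′} {v} (labels-persist P))))
             (∑-mono-≤ (closure φ) (deficit-mono P))

  potential-<-label : ∀ {S S′ v χ} → (∀ {χ} → cs S (v ⊨c χ) → cs S′ (v ⊨c χ)) → χ ∈ closure φ →
                      cs S′ (v ⊨c χ) → ¬ cs S (v ⊨c χ) → potential S′ v < potential S v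
  potential-<-label {S} {S′} {v} keep χ∈ new fresh =
    weighted-< (deficits S v) (∑-mono-< {f = labelled S v} {labelled S′ v} χ∈ (λ χ → 𝟙-mono keep) (𝟙-< fresh new))
               (labels-≤ S′ v) (deficits-≤ S′ v)

  potential-<-count : ∀ {S S′ v ω n ψ} → Persists S S′ v → dia≥ ω n ψ ∈ closure φ →
                      countUpTo n (Counted S v ω ψ) < countUpTo n (Counted S′ v ω ψ) → potential S′ v < potential S v
  potential-<-count {S} {S′} {v} {ω} {n} {ψ} P ≥∈ more =
    +-mono-≤-< (*-monoˡ-≤ (suc N) (∸-monoʳ-≤ C (labels-mono {S} {S′} {v} (labels-persist P))))
               (∑-mono-< ≥∈ (deficit-mono P) (∸-monoʳ-< more (countUpTo-≤ n (Counted S′ v ω ψ))))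

  -- Unused variables are put at depth D + 1, outside the levels that the measure counts.
  record Layered (S : State) (depth : ℕ → ℕ) (B : ℕ) : Set where
    field
      wellFormed    : WellFormed φ S B
      depth-child   : ∀ {u v} → prec S u v → depth v ≡ suc (depth u)
      label-closure : ∀ {x ψ} → cs S (x ⊨c ψ) → ψ ∈ closure φ
      label-depth   : ∀ {x ψ} → cs S (x ⊨c ψ) → depth x + modalDepth ψ ≤ D
      edge-tree     : ∀ {R u v} → cs S (edge R u v) → prec S u v ⊎ prec S v u
      unique-parent : ∀ {u u′ v} → prec S u v → prec S u′ v → u ≡ u′
      orphan-depth  : ∀ {v} → (∀ {u} → ¬ prec S u v) → v ≢ 0 → depth v ≡ suc D
  open Layered

  labelled-bounds : ∀ {S depth B x ψ} → Layered S depth B → cs S (x ⊨c ψ) → x < B × depth x ≤ D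
  labelled-bounds L x∈ = mentions<B (wellFormed L) x∈ refl , m+n≤o⇒m≤o _ (label-depth L x∈)

  descendant-deeper : ∀ {S depth B} → Layered S depth B → ∀ {a b} → TransClosure (prec S) a b → depth a < depth b
  descendant-deeper L [ a≺b ]     = ≤-reflexive (sym (depth-child L a≺b))
  descendant-deeper L (a≺c ∷ c≺⁺b) = <-trans (≤-reflexive (sym (depth-child L a≺c))) (descendant-deeper L c≺⁺b)

  modalAt-bounds : ∀ {S depth B x σ ψ} → Layered S depth B → ModalAt S x σ ψ →
                   ψ ∈ closure φ × depth x + suc (modalDepth ψ) ≤ D
  modalAt-bounds L (_ , inj₁ ≥∈) = closure-components (label-closure L ≥∈) (here refl) , label-depth L ≥∈
  modalAt-bounds L (_ , inj₂ ≤∈) = closure-components (label-closure L ≤∈) (here refl) , label-depth L ≤∈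

  restrict : ℕ → ℕ → ℕ → ℕ
  restrict a d x with a ≟ d
  ... | yes _ = x
  ... | no  _ = 0

  restrict-≡ : ∀ {a d} x → a ≡ d → restrict a d x ≡ x
  restrict-≡ {a} {d} x a≡d with a ≟ d
  ... | yes _   = refl
  ... | no  a≢d = ⊥-elim (a≢d a≡d)

  restrict-≢ : ∀ {a d} x → a ≢ d → restrict a d x ≡ 0
  restrict-≢ {a} {d} x a≢d with a ≟ d
  ... | yes a≡d = ⊥-elim (a≢d a≡d)
  ... | no  _   = refl

  levelPotential : State → (ℕ → ℕ) → ℕ → ℕ → ℕ
  levelPotential S depth B d = ∑< B (λ v → restrict (depth v) d (potential S v))

  measure : State → (ℕ → ℕ) → ℕ → Vec ℕ (suc D)
  measure S depth B = tabulate (levelPotential S depth B ∘ toℕ)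

  levelPotential-vanishing : ∀ {S depth B B′} → Layered S depth B → B ≤ B′ → ∀ {d} → d ≤ D →
                             levelPotential S depth B′ d ≡ levelPotential S depth B d
  levelPotential-vanishing {S} {depth} {B} L B≤B′ {d} d≤D = ∑<-vanishing B≤B′ unused
    where
    unused : ∀ v → B ≤ v → restrict (depth v) d (potential S v) ≡ 0
    unused v B≤v = restrict-≢ _ λ depth≡d → <-irrefl (sym depth≡d) (≤-<-trans d≤D (≤-reflexive (sym depth≡D+1)))
      where
      depth≡D+1 : depth v ≡ suc D
      depth≡D+1 = orphan-depth L (λ u≺v → <-irrefl refl (≤-trans (proj₂ (prec<B (wellFormed L) u≺v)) B≤v))
                                 (λ { refl → <-irrefl refl (≤-trans (mentions<B (wellFormed L) (root-label (wellFormed L)) refl) B≤v) })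

  -- Levels deeper than the acting variable t may grow arbitrarily; the measure is lexicographic from the root.
  measure-decreases : ∀ {S S′ depth depth′ B B′} → Layered S depth B → B ≤ B′ → ∀ {t} → t < B → depth t ≤ D →
                      depth′ t ≡ depth t → (∀ {v} → depth′ v ≤ depth t → depth v ≡ depth′ v) →
                      (∀ {v} → v ≢ t → depth v ≤ depth t → potential S′ v ≤ potential S v) →
                      potential S′ t < potential S t →
                      measure S′ depth′ B′ <ₗₑₓ measure S depth B
  measure-decreases {S} {S′} {depth} {depth′} {B} {B′} L B≤B′ {t} t<B t≤D same-t same-above others acting =
    tabulate-<ₗₑₓ (depth t) (s≤s t≤D) (λ d d<t → level-≤ (<⇒≤ d<t)) level-<
    where
    pointwise : ∀ {d} → d ≤ depth t → ∀ v → v < B′ →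
                restrict (depth′ v) d (potential S′ v) ≤ restrict (depth v) d (potential S v)
    pointwise {d} d≤t v _ with depth′ v ≟ d
    ... | no _ = z≤n
    ... | yes refl with v ≟ t
    ...   | yes refl = ≤-trans (<⇒≤ acting) (≤-reflexive (sym (restrict-≡ _ (sym same-t))))
    ...   | no v≢t = ≤-trans (others v≢t (≤-trans (≤-reflexive same) d≤t)) (≤-reflexive (sym (restrict-≡ _ same)))
      where
      same : depth v ≡ depth′ v
      same = same-above d≤t
    level-≤ : ∀ {d} → d ≤ depth t → levelPotential S′ depth′ B′ d ≤ levelPotential S depth B d
    level-≤ d≤t = ≤-trans (∑<-mono-≤ B′ (pointwise d≤t))
                          (≤-reflexive (levelPotential-vanishing L B≤B′ (≤-trans d≤t t≤D)))
    level-< : levelPotential S′ depth′ B′ (depth t) < levelPotential S depth B (depth t)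
    level-< = <-≤-trans (∑<-mono-< B′ (<-≤-trans t<B B≤B′) (pointwise ≤-refl)
                          (subst₂ _<_ (sym (restrict-≡ _ same-t)) (sym (restrict-≡ _ refl)) acting))
                        (≤-reflexive (levelPotential-vanishing L B≤B′ t≤D))

  AdmissibleLabels : (ℕ → ℕ) → ℕ → (Con → Set) → Set
  AdmissibleLabels depth x New = ∀ {c} → New c → ∃[ ψ ] (c ≡ (x ⊨c ψ) × ψ ∈ closure φ × depth x + modalDepth ψ ≤ D)

  layered-extend : ∀ {S depth B x χ New} → Layered S depth B → cs S (x ⊨c χ) → AdmissibleLabels depth x New →
                   Layered (extend S New) depth B
  layered-extend {S} {depth} {New = New} L x∈ admissible = record
    { wellFormed = wellFormed-extend (wellFormed L) x∈ (λ new → let ψ , c≡ , _ = admissible new in ψ , c≡)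
    ; depth-child = depth-child L
    ; label-closure = λ ψ∈ → proj₁ (label ψ∈)
    ; label-depth = λ ψ∈ → proj₂ (label ψ∈)
    ; edge-tree = tree
    ; unique-parent = unique-parent L
    ; orphan-depth = orphan-depth L }
    where
    label : ∀ {v ψ} → cs S (v ⊨c ψ) ⊎ New (v ⊨c ψ) → ψ ∈ closure φ × depth v + modalDepth ψ ≤ D
    label (inj₁ ψ∈) = label-closure L ψ∈ , label-depth L ψ∈
    label (inj₂ new) with admissible new
    ... | _ , refl , bounds = bounds
    tree : ∀ {R u v} → cs S (edge R u v) ⊎ New (edge R u v) → prec S u v ⊎ prec S v u
    tree (inj₁ e) = edge-tree L e
    tree (inj₂ new) with admissible new
    ... | _ , () , _

  measure-extend : ∀ {S depth B x χ χ₀ New} → Layered S depth B → cs S (x ⊨c χ) →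
                   New (x ⊨c χ₀) → ¬ cs S (x ⊨c χ₀) → χ₀ ∈ closure φ →
                   measure (extend S New) depth B <ₗₑₓ measure S depth B
  measure-extend L x∈ new χ₀∉ χ₀∈ =
    measure-decreases L ≤-refl x<B x≤D refl (λ _ → refl) (λ _ _ → potential-mono (persists-⊆ inj₁))
                      (potential-<-label inj₁ χ₀∈ (inj₂ new) χ₀∉)
    where
    x<B = proj₁ (labelled-bounds L x∈)
    x≤D = proj₂ (labelled-bounds L x∈)

  successor-depth : ∀ {S depth B R x y m} → Layered S depth B → cs S (edge R x y) →
                    depth x + suc m ≤ D → depth y + m ≤ D
  successor-depth {depth = depth} {x = x} {y} {m} L xRy x+m<D with edge-tree L xRy
  ... | inj₁ x≺y = subst (λ k → k + m ≤ D) (sym (depth-child L x≺y)) (subst (_≤ D) (+-suc (depth x) m) x+m<D)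
  ... | inj₂ y≺x = ≤-trans (+-monoˡ-≤ m (≤-trans (n≤1+n (depth y)) (≤-reflexive (sym (depth-child L y≺x)))))
                           (≤-trans (+-monoʳ-≤ (depth x) (n≤1+n m)) x+m<D)

  layered-prune : ∀ {S depth B x ω ψ y} b → Layered S depth B → ChooseApplicable S x ω ψ y →
                  Layered (prune S y (pick b ψ)) depth B
  layered-prune {S} {depth} {ψ = ψ} {y} b L (mod , (_ , _ , xRy) , _) = record
    { wellFormed = wellFormed-prune (wellFormed L) xRy
    ; depth-child = depth-child L
    ; label-closure = λ ψ∈ → proj₁ (label ψ∈)
    ; label-depth = λ ψ∈ → proj₂ (label ψ∈)
    ; edge-tree = λ { (inj₁ (e , _)) → edge-tree L e ; (inj₂ ()) }
    ; unique-parent = unique-parent L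
    ; orphan-depth = orphan-depth L }
    where
    label : ∀ {v χ} → cs (prune S y (pick b ψ)) (v ⊨c χ) → χ ∈ closure φ × depth v + modalDepth χ ≤ D
    label (inj₁ (χ∈ , _)) = label-closure L χ∈ , label-depth L χ∈
    label (inj₂ refl) = closure-pick b (proj₁ (modalAt-bounds L mod))
                      , ≤-trans (+-monoʳ-≤ (depth y) (modalDepth-pick b ψ)) (successor-depth L xRy (proj₂ (modalAt-bounds L mod)))

  survives-prune : ∀ {S y χ c} → cs S c → (∀ {z} → Mentions c z → ¬ TransClosure (prec S) y z) → cs (prune S y χ) c
  survives-prune c∈ undeleted = inj₁ (c∈ , λ (_ , y≺⁺z , m) → undeleted m y≺⁺z)

  not-descendant : ∀ {S depth B y v} → Layered S depth B → depth v ≤ depth y → ¬ TransClosure (prec S) y v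
  not-descendant L v≤y y≺⁺v = <-irrefl refl (<-≤-trans (descendant-deeper L y≺⁺v) v≤y)

  -- A neighbour u of v is v's child or parent; in the first case a path y ≺⁺ u must pass through v.
  neighbour-not-descendant : ∀ {S depth B y v R u} → Layered S depth B → v ≢ y → depth v ≤ depth y →
                             cs S (edge R v u) → ¬ TransClosure (prec S) y u
  neighbour-not-descendant {S} {y = y} L v≢y v≤y vRu y≺⁺u with edge-tree L vRu
  ... | inj₂ u≺v = not-descendant L v≤y (y≺⁺u ∷ʳ u≺v)
  ... | inj₁ v≺u with TransClosure-unsnoc y≺⁺u
  ...   | inj₁ y≺u             = v≢y (unique-parent L v≺u y≺u)
  ...   | inj₂ (w , y≺⁺w , w≺u) = not-descendant L v≤y (subst (TransClosure (prec S) y) (sym (unique-parent L v≺u w≺u)) y≺⁺w)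

  prune-persists : ∀ {S depth B y v χ} → Layered S depth B → v ≢ y → depth v ≤ depth y → Persists S (prune S y χ) v
  prune-persists {S} {y = y} {v} {χ} L v≢y v≤y = record
    { labels-persist = λ ψ∈ → survives-prune {S} {y} {χ} ψ∈ λ { refl → not-descendant L v≤y }
    ; counted-persist = counted }
    where
    counted : ∀ {ω ψ u} → Counted S v ω ψ u → Counted (prune S y χ) v ω ψ u
    counted {_ ∷ _} (edges , ψ∈) =
      All.map (λ e → survives-prune {S} {y} {χ} e λ { (inj₁ refl) → not-descendant L v≤y ; (inj₂ refl) → u-kept }) edges
      , survives-prune {S} {y} {χ} ψ∈ λ { refl → u-kept }
      where u-kept = neighbour-not-descendant L v≢y v≤y (All.head edges)

  measure-prune : ∀ {S depth B x ω ψ y} b → Layered S depth B → ChooseApplicable S x ω ψ y →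
                  measure (prune S y (pick b ψ)) depth B <ₗₑₓ measure S depth B
  measure-prune {S} {ψ = ψ} {y} b L (mod , (_ , _ , xRy) , ψ∉ , ∼ψ∉) =
    measure-decreases L ≤-refl y<B y≤D refl (λ _ → refl) (λ v≢y v≤y → potential-mono (prune-persists L v≢y v≤y))
                      (potential-<-label (λ χ∈ → survives-prune {S} {y} {pick b ψ} χ∈ λ { refl → not-descendant L ≤-refl })
                                         (closure-pick b (proj₁ (modalAt-bounds L mod))) (inj₂ refl) (pick∉ b))
    where
    y<B = mentions<B (wellFormed L) xRy (inj₂ refl)
    y≤D = m+n≤o⇒m≤o _ (successor-depth L xRy (proj₂ (modalAt-bounds L mod)))
    pick∉ : ∀ b → ¬ cs S (y ⊨c pick b ψ)
    pick∉ true  = ψ∉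
    pick∉ false = ∼ψ∉

  fresh-[↦] : ∀ {S y c v} (depth : ℕ → ℕ) d → Fresh S y → cs S c → Mentions c v → (depth [ y ↦ d ]) v ≡ depth v
  fresh-[↦] depth d (unmentioned , _) c∈ m = [↦]-other depth d λ { refl → unmentioned _ c∈ m }

  addSuccessor-label-bounds : ∀ {S depth B x ω n ψ y choice Rs} → Layered S depth B → cs S (x ⊨c dia≥ ω n ψ) →
                              Fresh S y → ∀ {v χ} → cs (addSuccessor S x ψ y choice Rs) (v ⊨c χ) →
                              χ ∈ closure φ × (depth [ y ↦ suc (depth x) ]) v + modalDepth χ ≤ D
  addSuccessor-label-bounds {S} {depth} {x = x} {ψ = ψ} {y} {choice} {Rs} L ≥∈ fresh = label
    where
    y-depth : ∀ {m} → depth x + suc m ≤ D → (depth [ y ↦ suc (depth x) ]) y + m ≤ D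
    y-depth {m} x+m<D = subst (λ k → k + m ≤ D) (sym ([↦]-same depth y _)) (subst (_≤ D) (+-suc (depth x) m) x+m<D)
    label : ∀ {v χ} → cs (addSuccessor S x ψ y choice Rs) (v ⊨c χ) →
            χ ∈ closure φ × (depth [ y ↦ suc (depth x) ]) v + modalDepth χ ≤ D
    label {χ = χ} (inj₁ χ∈) = label-closure L χ∈
                            , subst (λ k → k + modalDepth χ ≤ D) (sym (fresh-[↦] {S} depth _ fresh χ∈ refl)) (label-depth L χ∈)
    label (inj₂ (inj₁ refl)) = closure-components (label-closure L ≥∈) (here refl) , y-depth (label-depth L ≥∈)
    label (inj₂ (inj₂ (inj₁ (ψ′ , (_ , mod) , refl)))) =
      closure-pick (choice ψ′) (proj₁ (modalAt-bounds L mod))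
      , y-depth (≤-trans (+-monoʳ-≤ (depth x) (s≤s (modalDepth-pick (choice ψ′) ψ′))) (proj₂ (modalAt-bounds L mod)))
    label (inj₂ (inj₂ (inj₂ (_ , _ , inj₁ ()))))
    label (inj₂ (inj₂ (inj₂ (_ , _ , inj₂ ()))))

  layered-addSuccessor : ∀ {S depth B x ω n ψ y choice Rs} → Layered S depth B → cs S (x ⊨c dia≥ ω n ψ) → Fresh S y →
                         Layered (addSuccessor S x ψ y choice Rs) (depth [ y ↦ suc (depth x) ]) (suc (B ⊔ y))
  layered-addSuccessor {S} {depth} {x = x} {ψ = ψ} {y} {choice} {Rs} L ≥∈ fresh = record
    { wellFormed = wellFormed-addSuccessor (wellFormed L) ≥∈ fresh
    ; depth-child = child
    ; label-closure = λ χ∈ → proj₁ (addSuccessor-label-bounds L ≥∈ fresh χ∈)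
    ; label-depth = λ χ∈ → proj₂ (addSuccessor-label-bounds L ≥∈ fresh χ∈)
    ; edge-tree = tree
    ; unique-parent = parent
    ; orphan-depth = orphan }
    where
    S′ = addSuccessor S x ψ y choice Rs
    depth′ = depth [ y ↦ suc (depth x) ]
    no-parent : ∀ u → ¬ prec S u y
    no-parent = proj₁ (proj₂ fresh)
    no-child : ∀ u → ¬ prec S y u
    no-child = proj₂ (proj₂ fresh)
    child : ∀ {u v} → prec S′ u v → depth′ v ≡ suc (depth′ u)
    child {u} {v} (inj₁ u≺v) = begin
      depth′ v        ≡⟨ [↦]-other depth _ (λ { refl → no-parent u u≺v }) ⟩
      depth v         ≡⟨ depth-child L u≺v ⟩
      suc (depth u)   ≡⟨ cong suc ([↦]-other depth _ (λ { refl → no-child v u≺v })) ⟨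
      suc (depth′ u)  ∎
      where open ≡-Reasoning
    child (inj₂ (refl , refl)) = trans ([↦]-same depth y _) (cong suc (sym (fresh-[↦] {S} depth _ fresh ≥∈ refl)))
    tree : ∀ {R u v} → cs S′ (edge R u v) → prec S′ u v ⊎ prec S′ v u
    tree (inj₁ e)                                  = Sum.map inj₁ inj₁ (edge-tree L e)
    tree (inj₂ (inj₁ ()))
    tree (inj₂ (inj₂ (inj₁ (_ , _ , ()))))
    tree (inj₂ (inj₂ (inj₂ (_ , _ , inj₁ refl)))) = inj₁ (inj₂ (refl , refl))
    tree (inj₂ (inj₂ (inj₂ (_ , _ , inj₂ refl)))) = inj₂ (inj₂ (refl , refl))
    parent : ∀ {u u′ v} → prec S′ u v → prec S′ u′ v → u ≡ u′
    parent (inj₁ u≺v)           (inj₁ u′≺v)           = unique-parent L u≺v u′≺v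
    parent (inj₁ u≺y)           (inj₂ (refl , refl)) = ⊥-elim (no-parent _ u≺y)
    parent (inj₂ (refl , refl)) (inj₁ u′≺y)           = ⊥-elim (no-parent _ u′≺y)
    parent (inj₂ (refl , refl)) (inj₂ (refl , refl)) = refl
    orphan : ∀ {v} → (∀ {u} → ¬ prec S′ u v) → v ≢ 0 → depth′ v ≡ suc D
    orphan no-parent′ v≢0 = trans ([↦]-other depth _ (λ { refl → no-parent′ (inj₂ (refl , refl)) }))
                                  (orphan-depth L (no-parent′ ∘ inj₁) v≢0)

  measure-addSuccessor : ∀ {S depth B x ω n ψ y choice Rs} → Layered S depth B → cs S (x ⊨c dia≥ ω n ψ) →
                         ¬ AtLeast n (Counted S x ω ψ) → Fresh S y → All (_∈ Rs) (toList ω) →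
                         measure (addSuccessor S x ψ y choice Rs) (depth [ y ↦ suc (depth x) ]) (suc (B ⊔ y))
                           <ₗₑₓ measure S depth B
  measure-addSuccessor {S} {depth} {B} {x} {n = n} {y = y} L ≥∈ few fresh ω⊆Rs =
    measure-decreases L (m≤n⇒m≤1+n (m≤m⊔n B y)) x<B x≤D (fresh-[↦] {S} depth _ fresh ≥∈ refl) same-above
                      (λ _ _ → potential-mono (persists-⊆ inj₁))
                      (potential-<-count (persists-⊆ inj₁) (label-closure L ≥∈)
                                         (countUpTo-< n few (λ _ (edges , ψ∈) → All.map inj₁ edges , inj₁ ψ∈)
                                                      y-counted y-uncounted))
    where
    x<B = proj₁ (labelled-bounds L ≥∈)
    x≤D = proj₂ (labelled-bounds L ≥∈)
    same-above : ∀ {v} → (depth [ y ↦ suc (depth x) ]) v ≤ depth x → depth v ≡ (depth [ y ↦ suc (depth x) ]) v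
    same-above {v} v≤x with v ≟ y
    ... | yes refl = ⊥-elim (1+n≰n v≤x)
    ... | no _     = refl
    y-counted = All.map (λ {R} R∈ → inj₂ (inj₂ (inj₂ (R , R∈ , inj₁ refl)))) ω⊆Rs , inj₂ (inj₁ refl)
    y-uncounted = λ (_ , ψ∈) → proj₁ fresh _ ψ∈ refl

  component-bounds : ∀ {S depth B x χ c} → Layered S depth B → cs S (x ⊨c χ) → c ∈ components χ →
                     c ∈ closure φ × depth x + modalDepth c ≤ D
  component-bounds {depth = depth} {x = x} {χ} L χ∈ c∈ =
    closure-components (label-closure L χ∈) c∈ , ≤-trans (+-monoʳ-≤ (depth x) (modalDepth-components χ c∈)) (label-depth L χ∈)

  nextDepth : ∀ {S S′} → Step S S′ → (ℕ → ℕ) → ℕ → ℕ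
  nextDepth (≥-rule _ x _ _ _ y _ _ _ _ _ _ _) depth = depth [ y ↦ suc (depth x) ]
  nextDepth _                                  depth = depth

  layered-step : ∀ {S S′ depth B} → Layered S depth B → (st : Step S S′) →
                 Layered S′ (nextDepth st depth) (nextBound st B)
  layered-step L (∧-rule _ _ a b a∧b _) = layered-extend L a∧b λ
    { (inj₁ refl) → a , refl , component-bounds L a∧b (here refl)
    ; (inj₂ refl) → b , refl , component-bounds L a∧b (there (here refl)) }
  layered-step L (∨-rule _ _ _ _ χ a∨b _ _ chosen) = layered-extend L a∨b λ
    { refl → χ , refl , component-bounds L a∨b (disjunct∈ chosen) }
  layered-step L (choose-rule _ _ _ _ _ b applicable) = layered-prune b L applicable
  layered-step L (≥-rule _ _ _ _ _ _ _ _ ≥∈ _ _ fresh _) = layered-addSuccessor L ≥∈ fresh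

  measure-step : ∀ {S S′ depth B} → Layered S depth B → (st : Step S S′) →
                 measure S′ (nextDepth st depth) (nextBound st B) <ₗₑₓ measure S depth B
  measure-step L (∧-rule S x a _ a∧b missing) with lem {cs S (x ⊨c a)}
  ... | no a∉  = measure-extend L a∧b (inj₁ refl) a∉ (proj₁ (component-bounds L a∧b (here refl)))
  ... | yes a∈ = measure-extend L a∧b (inj₂ refl) (λ b∈ → missing (a∈ , b∈))
                                (proj₁ (component-bounds L a∧b (there (here refl))))
  measure-step L (∨-rule S x a b χ a∨b a∉ b∉ chosen) =
    measure-extend L a∨b refl (χ∉ chosen) (proj₁ (component-bounds L a∨b (disjunct∈ chosen)))
    where
    χ∉ : χ ≡ a ⊎ χ ≡ b → ¬ cs S (x ⊨c χ)
    χ∉ (inj₁ refl) = a∉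
    χ∉ (inj₂ refl) = b∉
  measure-step L (choose-rule _ _ _ _ _ b applicable)           = measure-prune b L applicable
  measure-step L (≥-rule _ _ _ _ _ _ _ _ ≥∈ few _ fresh ω⊆Rs) = measure-addSuccessor L ≥∈ few fresh ω⊆Rs

  Annotation : State → Set
  Annotation S = Σ (ℕ → ℕ) λ depth → Σ ℕ λ B → Layered S depth B

  measureOf : ∀ {S} → Annotation S → Vec ℕ (suc D)
  measureOf {S} (depth , B , _) = measure S depth B

  annotate-step : ∀ {S S′} → Annotation S → Step S S′ → Annotation S′
  annotate-step (depth , B , L) st = nextDepth st depth , nextBound st B , layered-step L st

  initial-annotation : Annotation (initial φ)
  initial-annotation = depth₀ , 1 , record
    { wellFormed = initial-wellFormed φ
    ; depth-child = λ ()
    ; label-closure = λ { refl → closure-self φ }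
    ; label-depth = λ { refl → ≤-reflexive (cong (_+ D) ([↦]-same (λ _ → suc D) 0 0)) }
    ; edge-tree = λ ()
    ; unique-parent = λ ()
    ; orphan-depth = λ _ v≢0 → [↦]-other _ 0 v≢0 }
    where
    depth₀ = (λ _ → suc D) [ 0 ↦ 0 ]

  all-runs-finite : AllRunsFinite φ
  all-runs-finite (s , s₀ , steps) = wellFounded⇒noInfiniteDescent <ₗₑₓ-wellFounded (measureOf ∘ annotation) descending
    where
    annotation : ∀ i → Annotation (s i)
    annotation zero    = subst Annotation (sym s₀) initial-annotation
    annotation (suc i) = annotate-step (annotation i) (steps i)
    descending : ∀ i → measureOf (annotation (suc i)) <ₗₑₓ measureOf (annotation i)
    descending i = measure-step (proj₂ (proj₂ (annotation i))) (steps i)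

module ModelGuidedRun (lem : ExcludedMiddle 0ℓ) {Atom RName : Set} (p₀ : Atom) (φ : Gr.Fm Atom RName p₀)
                 (M : Gr.Model Atom RName p₀) where
  open Gr Atom RName p₀
  open Model M
  open Closure {Atom} {RName} p₀
  open Reachable {Atom} {RName} p₀
  open Classical lem
  open Semantics lem p₀ M

  _⊨ᴹ_ : W → Fm → Set
  w ⊨ᴹ ψ = _⊨_ M w ψ

  record Embedding (S : State) (π : ℕ → W) (B : ℕ) : Set where
    field
      wellFormed          : WellFormed φ S B
      label-sound         : ∀ {x ψ} → cs S (x ⊨c ψ) → ψ ∈ closure φ × π x ⊨ᴹ ψ
      edge-sound          : ∀ {R x y} → cs S (edge R x y) → relSem M R (π x) (π y)
      edges-saturated     : ∀ {R₀ R x y} → cs S (edge R₀ x y) → R ∈ relLits φ → relSem M R (π x) (π y) →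
                            cs S (edge R x y)
      successor-injective : ∀ {R₁ R₂ x y₁ y₂} → cs S (edge R₁ x y₁) → cs S (edge R₂ x y₂) →
                            π y₁ ≡ π y₂ → y₁ ≡ y₂
  open Embedding

  Embeddable : State → Set
  Embeddable S = Σ (ℕ → W) λ π → Σ ℕ λ B → Embedding S π B

  -- Rules other than the ≥-rule add no edges, and keep or drop all edges between two variables together.
  embedding-sameEdges : ∀ {S S′ π B B′} → Embedding S π B → WellFormed φ S′ B′ →
                        (∀ {x ψ} → cs S′ (x ⊨c ψ) → ψ ∈ closure φ × π x ⊨ᴹ ψ) →
                        (∀ {R u v} → cs S′ (edge R u v) → cs S (edge R u v)) →
                        (∀ {R R′ u v} → cs S′ (edge R u v) → cs S (edge R′ u v) → cs S′ (edge R′ u v)) →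
                        Embedding S′ π B′
  embedding-sameEdges E wf′ labels ⊆S together = record
    { wellFormed = wf′
    ; label-sound = labels
    ; edge-sound = edge-sound E ∘ ⊆S
    ; edges-saturated = λ e R∈ holds → together e (edges-saturated E (⊆S e) R∈ holds)
    ; successor-injective = λ e₁ e₂ → successor-injective E (⊆S e₁) (⊆S e₂) }

  modal-closure : ∀ {S π B x σ ψ} → Embedding S π B → ModalAt S x σ ψ → ψ ∈ closure φ
  modal-closure E (_ , inj₁ ≥∈) = closure-components (proj₁ (label-sound E ≥∈)) (here refl)
  modal-closure E (_ , inj₂ ≤∈) = closure-components (proj₁ (label-sound E ≤∈)) (here refl)

  RuleApplicable : State → Set
  RuleApplicable S = (∃[ x ] ∧Applicable S x) ⊎ (∃[ x ] ∨Applicable S x)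
                   ⊎ (∃[ x ] ∃[ ω ] ∃[ ψ ] ∃[ y ] ChooseApplicable S x ω ψ y)
                   ⊎ (∃[ x ] ∃[ ω ] ∃[ n ] ∃[ ψ ]
                        (cs S (x ⊨c dia≥ ω n ψ) × ¬ AtLeast n (Counted S x ω ψ) × NoLocalRule S x))

  step⇒ruleApplicable : ∀ {S S′} → Step S S′ → RuleApplicable S
  step⇒ruleApplicable (∧-rule S x a b a∧b missing)          = inj₁ (x , a , b , a∧b , missing)
  step⇒ruleApplicable (∨-rule S x a b _ a∨b a∉ b∉ _)        = inj₂ (inj₁ (x , a , b , a∨b , a∉ , b∉))
  step⇒ruleApplicable (choose-rule S x ω ψ y _ applicable)   = inj₂ (inj₂ (inj₁ (x , ω , ψ , y , applicable)))
  step⇒ruleApplicable (≥-rule S x ω n ψ _ _ _ ≥∈ few local _ _) = inj₂ (inj₂ (inj₂ (x , ω , n , ψ , ≥∈ , few , local)))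

  GuidedStep : State → Set₁
  GuidedStep S = Σ State λ S′ → Step S S′ × Embeddable S′

  guided-∧ : ∀ {S π B x a b} → Embedding S π B → cs S (x ⊨c (a ∧′ b)) → ¬ (cs S (x ⊨c a) × cs S (x ⊨c b)) →
             GuidedStep S
  guided-∧ {S} {π} {B} {x} {a} {b} E a∧b missing =
    _ , step , π , B , embedding-sameEdges E (wellFormed-step (wellFormed E) step) labels old (λ _ → inj₁)
    where
    step = ∧-rule S x a b a∧b missing
    labels : ∀ {v χ} → cs S (v ⊨c χ) ⊎ (v ⊨c χ) ≡ (x ⊨c a) ⊎ (v ⊨c χ) ≡ (x ⊨c b) →
             χ ∈ closure φ × π v ⊨ᴹ χ
    labels (inj₁ χ∈)         = label-sound E χ∈
    labels (inj₂ (inj₁ refl)) = closure-components (proj₁ (label-sound E a∧b)) (here refl)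
                              , proj₁ (proj₂ (label-sound E a∧b))
    labels (inj₂ (inj₂ refl)) = closure-components (proj₁ (label-sound E a∧b)) (there (here refl))
                              , proj₂ (proj₂ (label-sound E a∧b))
    old : ∀ {R u v} → cs S (edge R u v) ⊎ edge R u v ≡ (x ⊨c a) ⊎ edge R u v ≡ (x ⊨c b) → cs S (edge R u v)
    old (inj₁ e) = e
    old (inj₂ (inj₁ ()))
    old (inj₂ (inj₂ ()))

  guided-∨ : ∀ {S π B x a b} → Embedding S π B → cs S (x ⊨c (a ∨′ b)) → ¬ cs S (x ⊨c a) → ¬ cs S (x ⊨c b) →
             GuidedStep S
  guided-∨ {S} {π} {B} {x} {a} {b} E a∨b a∉ b∉ =
    [ disjunct a (inj₁ refl) , disjunct b (inj₂ refl) ]′ (proj₂ (label-sound E a∨b))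
    where
    disjunct : ∀ χ → χ ≡ a ⊎ χ ≡ b → π x ⊨ᴹ χ → GuidedStep S
    disjunct χ chosen ⊨χ = _ , step , π , B , embedding-sameEdges E (wellFormed-step (wellFormed E) step) labels old (λ _ → inj₁)
      where
      step = ∨-rule S x a b χ a∨b a∉ b∉ chosen
      labels : ∀ {v χ′} → cs S (v ⊨c χ′) ⊎ (v ⊨c χ′) ≡ (x ⊨c χ) → χ′ ∈ closure φ × π v ⊨ᴹ χ′
      labels (inj₁ χ∈) = label-sound E χ∈
      labels (inj₂ refl) = closure-components (proj₁ (label-sound E a∨b)) (disjunct∈ chosen) , ⊨χ
      old : ∀ {R u v} → cs S (edge R u v) ⊎ edge R u v ≡ (x ⊨c χ) → cs S (edge R u v)
      old (inj₁ e) = e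
      old (inj₂ ())

  guided-choose : ∀ {S π B x ω ψ y} → Embedding S π B → ChooseApplicable S x ω ψ y → GuidedStep S
  guided-choose {S} {π} {B} {x} {ω} {ψ} {y} E applicable@(mod , _) =
    _ , step , π , B , embedding-sameEdges E (wellFormed-step (wellFormed E) step) labels old together
    where
    b = does (lem {π y ⊨ᴹ ψ})
    step = choose-rule S x ω ψ y b applicable
    labels : ∀ {v χ} → cs (prune S y (pick b ψ)) (v ⊨c χ) → χ ∈ closure φ × π v ⊨ᴹ χ
    labels (inj₁ (χ∈ , _)) = label-sound E χ∈
    labels (inj₂ refl)     = closure-pick b (modal-closure E mod) , ⊨-pick-does ψ (π y)
    old : ∀ {R u v} → cs (prune S y (pick b ψ)) (edge R u v) → cs S (edge R u v)
    old (inj₁ (e , _)) = e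
    old (inj₂ ())
    together : ∀ {R R′ u v} → cs (prune S y (pick b ψ)) (edge R u v) → cs S (edge R′ u v) →
               cs (prune S y (pick b ψ)) (edge R′ u v)
    together (inj₁ (_ , kept)) e = inj₁ (e , kept)
    together (inj₂ ())         e

  -- The new variable of the ≥-rule goes to one of the n required successor worlds not yet hit by a counted successor.
  module NewSuccessor {S π B x ω n ψ} (E : Embedding S π B) (≥∈ : cs S (x ⊨c dia≥ ω n ψ))
                      (few : ¬ AtLeast n (Counted S x ω ψ)) (noLocal : NoLocalRule S x) where

    ≥-true : π x ⊨ᴹ dia≥ ω n ψ
    ≥-true = proj₂ (label-sound E ≥∈)

    missed : ∃[ i ] (∀ {y} → Counted S x ω ψ y → π y ≢ proj₁ ≥-true i)
    missed = missed-witness π (proj₁ ≥-true) (proj₁ (proj₂ ≥-true)) few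

    w′ : W
    w′ = proj₁ ≥-true (proj₁ missed)

    w′-unreached : ∀ {y} → Counted S x ω ψ y → π y ≢ w′
    w′-unreached = proj₂ missed

    w′-succ : Succ M ω (π x) w′ × w′ ⊨ᴹ ψ
    w′-succ = proj₂ (proj₂ ≥-true) (proj₁ missed)

    holds? : (R : RelLit) → Dec (relSem M R (π x) w′)
    holds? _ = lem

    Rs : List RelLit
    Rs = filter holds? (relLits φ)

    choice : Fm → Bool
    choice ψ′ = does (lem {w′ ⊨ᴹ ψ′})

    S′ : State
    S′ = addSuccessor S x ψ B choice Rs

    π′ : ℕ → W
    π′ = π [ B ↦ w′ ]

    fresh : Fresh S B
    fresh = fresh-bound (wellFormed E)

    ω⊆relLits : ∀ {R} → R ∈ toList ω → R ∈ relLits φ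
    ω⊆relLits = modalRels⊆relLits (proj₁ (label-sound E ≥∈))

    step : Step S S′
    step = ≥-rule S x ω n ψ B choice Rs ≥∈ few noLocal fresh
                  (All.tabulate λ R∈ → ∈-filter⁺ holds? (ω⊆relLits R∈) (All.lookup (proj₁ w′-succ) R∈))

    π′-old : ∀ {c v} → cs S c → Mentions c v → π′ v ≡ π v
    π′-old c∈ m = [↦]-other π w′ λ { refl → proj₁ fresh _ c∈ m }

    π′-x : π′ x ≡ π x
    π′-x = π′-old ≥∈ refl

    π′-new : π′ B ≡ w′
    π′-new = [↦]-same π B w′

    edge′⁻ : ∀ {R u v} → cs S′ (edge R u v) →
             cs S (edge R u v) ⊎ (u ≡ x × v ≡ B × R ∈ Rs) ⊎ (u ≡ B × v ≡ x × R ⁻¹ ∈ Rs)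
    edge′⁻ = addSuccessor-edge⁻ {S} {x} {ψ} {B} {choice} {Rs}

    Rs-sound : ∀ {R} → R ∈ Rs → relSem M R (π x) w′
    Rs-sound R∈ = proj₂ (∈-filter⁻ holds? {xs = relLits φ} R∈)

    label-sound′ : ∀ {v χ} → cs S′ (v ⊨c χ) → χ ∈ closure φ × π′ v ⊨ᴹ χ
    label-sound′ {χ = χ} (inj₁ χ∈) =
      proj₁ (label-sound E χ∈) , subst (_⊨ᴹ χ) (sym (π′-old χ∈ refl)) (proj₂ (label-sound E χ∈))
    label-sound′ (inj₂ (inj₁ refl)) =
      closure-components (proj₁ (label-sound E ≥∈)) (here refl) , subst (_⊨ᴹ ψ) (sym π′-new) (proj₂ w′-succ)
    label-sound′ (inj₂ (inj₂ (inj₁ (ψ′ , (_ , mod) , refl)))) =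
      closure-pick (choice ψ′) (modal-closure E mod) , subst (_⊨ᴹ pick (choice ψ′) ψ′) (sym π′-new) (⊨-pick-does ψ′ w′)
    label-sound′ (inj₂ (inj₂ (inj₂ (_ , _ , inj₁ ()))))
    label-sound′ (inj₂ (inj₂ (inj₂ (_ , _ , inj₂ ()))))

    edge-sound′ : ∀ {R u v} → cs S′ (edge R u v) → relSem M R (π′ u) (π′ v)
    edge-sound′ {R} e with edge′⁻ e
    ... | inj₁ old = subst₂ (relSem M R) (sym (π′-old old (inj₁ refl))) (sym (π′-old old (inj₂ refl))) (edge-sound E old)
    ... | inj₂ (inj₁ (refl , refl , R∈))   = subst₂ (relSem M R) (sym π′-x) (sym π′-new) (Rs-sound R∈)
    ... | inj₂ (inj₂ (refl , refl , R⁻¹∈)) =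
      subst₂ (relSem M R) (sym π′-new) (sym π′-x) (relSem-⁻¹⁻ R (Rs-sound R⁻¹∈))

    edges-saturated′ : ∀ {R₀ R u v} → cs S′ (edge R₀ u v) → R ∈ relLits φ → relSem M R (π′ u) (π′ v) →
                       cs S′ (edge R u v)
    edges-saturated′ {R = R} e R∈ holds with edge′⁻ e
    ... | inj₁ old = inj₁ (edges-saturated E old R∈
                             (subst₂ (relSem M R) (π′-old old (inj₁ refl)) (π′-old old (inj₂ refl)) holds))
    ... | inj₂ (inj₁ (refl , refl , _)) =
      inj₂ (inj₂ (inj₂ (R , ∈-filter⁺ holds? R∈ (subst₂ (relSem M R) π′-x π′-new holds) , inj₁ refl)))
    ... | inj₂ (inj₂ (refl , refl , _)) =
      inj₂ (inj₂ (inj₂ (R ⁻¹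
                       , ∈-filter⁺ holds? (relLits-⁻¹ φ R∈) (relSem-⁻¹⁺ R (subst₂ (relSem M R) π′-new π′-x holds))
                       , inj₂ (cong (λ Q → edge Q B x) (sym (⁻¹-involutive R))))))

    -- A successor of x mapped to w′ would be counted: it has all ω-edges by saturation, and ψ since no choose-rule applies at x.
    old-successor-misses : ∀ {R₁ y₁} → cs S (edge R₁ x y₁) → π y₁ ≢ w′
    old-successor-misses {y₁ = y₁} xR₁y₁ πy₁≡w′ = w′-unreached (edges , ψ-label) πy₁≡w′
      where
      edges : All (λ R → cs S (edge R x y₁)) (toList ω)
      edges = All.tabulate λ {R} R∈ →
        edges-saturated E xR₁y₁ (ω⊆relLits R∈) (subst (relSem M R (π x)) (sym πy₁≡w′) (All.lookup (proj₁ w′-succ) R∈))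
      ψ-label : cs S (y₁ ⊨c ψ)
      ψ-label = dne λ ψ∉ → proj₂ (proj₂ noLocal) ω ψ y₁
        ((n , inj₁ ≥∈) , (_ , here refl , All.head edges) , ψ∉
        , λ ∼ψ∈ → ⊨∼⇒⊭ ψ (proj₂ (label-sound E ∼ψ∈)) (subst (_⊨ᴹ ψ) (sym πy₁≡w′) (proj₂ w′-succ)))

    x≢B : x ≢ B
    x≢B = proj₁ fresh _ ≥∈

    no-old-edge-from-B : ∀ {R v} → ¬ cs S (edge R B v)
    no-old-edge-from-B e = proj₁ fresh _ e (inj₁ refl)

    successor-injective′ : ∀ {R₁ R₂ u y₁ y₂} → cs S′ (edge R₁ u y₁) → cs S′ (edge R₂ u y₂) →
                           π′ y₁ ≡ π′ y₂ → y₁ ≡ y₂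
    successor-injective′ e₁ e₂ same with edge′⁻ e₁ | edge′⁻ e₂
    ... | inj₁ old₁ | inj₁ old₂ =
      successor-injective E old₁ old₂ (trans (sym (π′-old old₁ (inj₂ refl))) (trans same (π′-old old₂ (inj₂ refl))))
    ... | inj₁ old₁ | inj₂ (inj₁ (refl , refl , _)) =
      ⊥-elim (old-successor-misses old₁ (trans (sym (π′-old old₁ (inj₂ refl))) (trans same π′-new)))
    ... | inj₂ (inj₁ (refl , refl , _)) | inj₁ old₂ =
      ⊥-elim (old-successor-misses old₂ (trans (sym (π′-old old₂ (inj₂ refl))) (trans (sym same) π′-new)))
    ... | inj₁ old₁ | inj₂ (inj₂ (refl , refl , _)) = ⊥-elim (no-old-edge-from-B old₁)
    ... | inj₂ (inj₂ (refl , refl , _)) | inj₁ old₂ = ⊥-elim (no-old-edge-from-B old₂)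
    ... | inj₂ (inj₁ (refl , refl , _)) | inj₂ (inj₁ (_ , refl , _)) = refl
    ... | inj₂ (inj₂ (refl , refl , _)) | inj₂ (inj₂ (_ , refl , _)) = refl
    ... | inj₂ (inj₁ (refl , _)) | inj₂ (inj₂ (x≡B , _)) = ⊥-elim (x≢B x≡B)
    ... | inj₂ (inj₂ (refl , _)) | inj₂ (inj₁ (B≡x , _)) = ⊥-elim (x≢B (sym B≡x))

    guided-≥ : GuidedStep S
    guided-≥ = S′ , step , π′ , suc (B ⊔ B) , record
      { wellFormed = wellFormed-addSuccessor (wellFormed E) ≥∈ fresh
      ; label-sound = label-sound′
      ; edge-sound = edge-sound′
      ; edges-saturated = edges-saturated′
      ; successor-injective = successor-injective′ }

  guided-step : ∀ {S π B} → Embedding S π B → RuleApplicable S → GuidedStep S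
  guided-step E (inj₁ (_ , _ , _ , a∧b , missing))                      = guided-∧ E a∧b missing
  guided-step E (inj₂ (inj₁ (_ , _ , _ , a∨b , a∉ , b∉)))               = guided-∨ E a∨b a∉ b∉
  guided-step E (inj₂ (inj₂ (inj₁ (_ , _ , _ , _ , applicable))))       = guided-choose E applicable
  guided-step E (inj₂ (inj₂ (inj₂ (_ , _ , _ , _ , ≥∈ , few , noLocal)))) = NewSuccessor.guided-≥ E ≥∈ few noLocal

  embedding-clashFree : ∀ {S π B} → Embedding S π B → ClashFree S
  embedding-clashFree E (inj₁ (_ , _ , v , ¬v)) = proj₂ (label-sound E ¬v) (proj₂ (label-sound E v))
  embedding-clashFree {π = π} E (inj₂ (_ , _ , _ , _ , ≤∈ , f , f-inj , counted)) =
    proj₂ (label-sound E ≤∈)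
      ( π ∘ f
      , (λ e → f-inj (successor-injective E (All.head (proj₁ (counted _))) (All.head (proj₁ (counted _))) e))
      , λ i → All.map (edge-sound E) (proj₁ (counted i)) , proj₂ (label-sound E (proj₂ (counted i))) )

  module Run (w : W) (w⊨φ : w ⊨ᴹ φ) where

    initial-embedding : Embedding (initial φ) (λ _ → w) 1
    initial-embedding = record
      { wellFormed = initial-wellFormed φ
      ; label-sound = λ { refl → closure-self φ , w⊨φ }
      ; edge-sound = λ ()
      ; edges-saturated = λ ()
      ; successor-injective = λ () }

    Guided : Set₁
    Guided = Σ State Embeddable

    -- Idles once no rule applies, so that the trace below is total.
    advance : Guided → Guided
    advance (S , π , B , E) with lem {RuleApplicable S}
    ... | yes applicable = let S′ , _ , embeddable = guided-step E applicable in S′ , embeddable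
    ... | no  _          = S , π , B , E

    advance-reachable : ∀ g → Star Step (proj₁ g) (proj₁ (advance g))
    advance-reachable (S , π , B , E) with lem {RuleApplicable S}
    ... | yes applicable = proj₁ (proj₂ (guided-step E applicable)) ◅ ε
    ... | no  _          = ε

    advance-step : ∀ g → RuleApplicable (proj₁ g) → Step (proj₁ g) (proj₁ (advance g))
    advance-step (S , π , B , E) applicable with lem {RuleApplicable S}
    ... | yes applicable′ = proj₁ (proj₂ (guided-step E applicable′))
    ... | no  stuck       = ⊥-elim (stuck applicable)

    trace : ℕ → Guided
    trace zero    = initial φ , _ , _ , initial-embedding
    trace (suc i) = advance (trace i)

    trace-reachable : ∀ i → Star Step (initial φ) (proj₁ (trace i))
    trace-reachable zero    = ε
    trace-reachable (suc i) = trace-reachable i ◅◅ advance-reachable (trace i)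

    some-run-succeeds : SomeRunSucceeds φ
    some-run-succeeds with lem {∃[ i ] ¬ RuleApplicable (proj₁ (trace i))}
    ... | yes (i , stuck) =
      proj₁ (trace i) , trace-reachable i , (λ _ st → stuck (step⇒ruleApplicable st))
      , embedding-clashFree (proj₂ (proj₂ (proj₂ (trace i))))
    ... | no never-stuck = ⊥-elim (Termination.all-runs-finite lem p₀ φ
      (proj₁ ∘ trace , refl , λ i → advance-step (trace i) (dne λ stuck → never-stuck (i , stuck))))

corollary3 : ExcludedMiddle 0ℓ → ∀ {Atom RName : Set} (p₀ : Atom) (φ : Gr.Fm Atom RName p₀) →
    Gr.AllRunsFinite Atom RName p₀ φ
      × (Gr.Satisfiable Atom RName p₀ φ ⇔ Gr.SomeRunSucceeds Atom RName p₀ φ)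
corollary3 lem p₀ φ =
  Termination.all-runs-finite lem p₀ φ
  , mk⇔ (λ (M , w , w⊨φ) → ModelGuidedRun.Run.some-run-succeeds lem p₀ φ M w w⊨φ)
        (CanonicalModel.succeeds⇒satisfiable lem p₀)
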